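{- Let $c_1(M)=\frac{|F_M|}{4\pi}=\frac{1}{12}M\prod_{p\mid M,\ p\text{ prime}}(1+p^{ -1})$, let $c_1^{\mathrm{new}}=c_1*\sigma_0^{ -1}$, and let $v(M)=12c_1^{\mathrm{new}}(M)$. Then $v$ is multiplicative and for every prime $p$ $$v(p^n)=\begin{cases}1&n=0\\ p-1&n=1\\ p^2-p-1&n=2\\ (p^3-p^2-p+1)p^{n-3}&n\ge 3.\end{cases}$$ Furthermore $\displaystyle L_v(s):=\sum_{n=1}^\infty\frac{v(n)}{n^s}=\frac{\zeta(s-1)}{\zeta(2s)\zeta(s)}$, where $\zeta$ is the Riemann zeta function.
   Context: $|F_M|$ is the hyperbolic area of a fundamental domain of the Hecke congruence group $\Gamma_0(M)$. Dirichlet convolution: $(f*g)(n)=\sum_{d\mid n}f(d)g(n/d)$; $\sigma_0(n)$ is the number of divisors of $n$ and $\sigma_0^{ -1}$ is its Dirichlet-convolution inverse. Multiplicative means $f(mn)=f(m)f(n)$ whenever $(m,n)=1$. -}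

module Defs where

open import Data.Nat as ℕ using (ℕ; zero; suc; _≟_; _∸_)
open import Data.Nat.Divisibility using (_∣?_)
open import Data.Nat.Primality using (prime?)
open import Data.Integer as ℤ using (ℤ; +_)
open import Data.Rational using (ℚ; _/_; 0ℚ; 1ℚ; _+_; _*_; -_)
open import Data.Bool using (Bool; true; false; if_then_else_; _∧_; _∨_)
open import Relation.Nullary.Decidable using (does)

-- Arithmetic functions: ℚ-valued functions on ℕ; only the values at
-- positive integers are meaningful (value at 0 is irrelevant).
Arith : Set
Arith = ℕ → ℚ

⟦_⟧ : ℤ → ℚ
⟦ z ⟧ = z / 1

sum1 : ℕ → (ℕ → ℚ) → ℚ
sum1 zero    f = 0ℚ
sum1 (suc n) f = sum1 n f + f (suc n)

_⋆_ : Arith → Arith → Arith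
(f ⋆ g) n = sum1 n (λ d → sum1 n (λ e →
  if does (d ℕ.* e ≟ n) then f d * g e else 0ℚ))

-- constant function 1 (Dirichlet series ζ(s))
one : Arith
one _ = 1ℚ

σ₀ : Arith
σ₀ n = sum1 n (λ d → if does (d ∣? n) then 1ℚ else 0ℚ)

-- Dirichlet inverse of f, for f with f(1) = 1, by the standard recursion
--   f⁻¹(1) = 1,  f⁻¹(n) = - Σ_{d e = n, d < n} f(e) f⁻¹(d)   (n > 1),
-- computed with fuel (fuel n suffices for argument n).
invFuel : Arith → ℕ → ℕ → ℚ
invFuel f zero    n = 0ℚ
invFuel f (suc k) n =
  if does (n ≟ 1) then 1ℚ
  else - sum1 (n ∸ 1) (λ d → sum1 n (λ e →
         if does (d ℕ.* e ≟ n) then f e * invFuel f k d else 0ℚ))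

dirichletInverse₁ : Arith → Arith
dirichletInverse₁ f n = invFuel f n n

-- σ₀⁻¹ (note σ₀(1) = 1)
σ₀⁻¹ : Arith
σ₀⁻¹ = dirichletInverse₁ σ₀

-- ∏_{p ∣ M, p prime} (1 + p⁻¹) = ∏ (p+1)/p ; p ranges over suc k, k < M
primeProd : ℕ → ℕ → ℚ
primeProd M zero    = 1ℚ
primeProd M (suc k) = primeProd M k *
  (if does (prime? (suc k)) ∧ does (suc k ∣? M)
   then + (suc (suc k)) / suc k else 1ℚ)

c₁ : Arith
c₁ M = (+ M / 12) * primeProd M M

c₁new : Arith
c₁new = c₁ ⋆ σ₀⁻¹

v : Arith
v M = (+ 12 / 1) * c₁new M

-- indicator of perfect squares (coefficients of ζ(2s))
anyUpTo : ℕ → (ℕ → Bool) → Bool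
anyUpTo zero    b = false
anyUpTo (suc n) b = anyUpTo n b ∨ b (suc n)

sqInd : Arith
sqInd n = if anyUpTo n (λ m → does (m ℕ.* m ≟ n)) then 1ℚ else 0ℚ

-- identity function n ↦ n (coefficients of ζ(s-1))
idA : Arith
idA n = ⟦ + n ⟧

-- All functions involved are multiplicative: ψ = 12 c₁ (Dedekind's ψ), σ₀ = 1 ⋆ 1 and hence its
-- Dirichlet inverse (by strong induction on n, comparing the expansions of (σ₀⁻¹ ⋆ σ₀)(m n) and
-- (σ₀⁻¹ ⋆ σ₀)(m) (σ₀⁻¹ ⋆ σ₀)(n) over pairs of divisors), and the indicator 1□ of squares. So
-- v = ψ ⋆ σ₀⁻¹ and (v ⋆ 1) ⋆ 1□ are multiplicative, and everything reduces to prime powers. There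
-- σ₀(pᵏ) = k + 1 forces σ₀⁻¹(pᵏ) = 1, −2, 1, 0, 0, …, so v(pⁿ) = ψ(pⁿ) − 2 ψ(pⁿ⁻¹) + ψ(pⁿ⁻²) with
-- ψ(pʲ⁺¹) = pʲ (p + 1). Summing, (v ⋆ 1)(pʲ) = pʲ − pʲ⁻² for j ≥ 2, and convolving with 1□, which
-- is 1 exactly at the even powers, telescopes to pᵏ. The identity ((v ⋆ 1) ⋆ 1□)(n) = n is the
-- coefficientwise form of L_v(s) ζ(s) ζ(2s) = ζ(s − 1).

module Submission where

open import Defs
open import Data.Nat using (ℕ; _≤_; _*_; _^_; _∸_)
open import Data.Nat.Coprimality using (Coprime)
open import Data.Nat.Primality using (Prime)
open import Data.Integer using (+_; _-_)
open import Data.Rational using (1ℚ)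
open import Data.Product using (_×_)
open import Relation.Binary.PropositionalEquality using (_≡_)

open import Algebra.Properties.Group using (x∙y⁻¹≈ε⇒x≈y)
open import Data.Bool using (true; false; if_then_else_; _∧_; _∨_; T)
import Data.Bool.Properties as Bool
open import Data.Empty using (⊥-elim)
import Data.Integer.Base as ℤ
import Data.Integer.Properties as ℤ
open import Data.List using ([]; _∷_)
open import Data.List.Relation.Unary.All using (_∷_)
open import Data.Nat.Base as ℕ using (zero; suc; pred; _+_; _<_; z≤n; s≤s)
import Data.Nat.Coprimality as Coprime
open import Data.Nat.Divisibility
open import Data.Nat.GCD
open import Data.Nat.Induction using (<-rec)
open import Data.Nat.Primality using (prime?; prime⇒irreducible; prime⇒nonZero; euclidsLemma)
open import Data.Nat.Primality.Factorisation using (factorise)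
import Data.Nat.Properties as ℕ
open import Data.Nat.Properties using (_≟_)
open import Data.Nat.Solver using () renaming (module +-*-Solver to ℕ-Solver)
open import Data.Product using (∃; _,_; proj₁; proj₂)
open import Data.Rational.Base using (ℚ; 0ℚ; toℚᵘ; _/_)
  renaming (_+_ to _⊕_; _*_ to _⊗_; -_ to ⊖_; _-_ to _⊖_)
import Data.Rational.Properties as ℚ
open import Data.Rational.Solver using () renaming (module +-*-Solver to ℚ-Solver)
open import Data.Rational.Unnormalised.Base using (mkℚᵘ; *≡*) renaming (_≃_ to _≃ᵘ_)
import Data.Rational.Unnormalised.Properties as ℚᵘ
open import Data.Sum using (_⊎_; inj₁; inj₂; [_,_])
open import Data.Unit using (tt)
open import Function using (_∘_; id)
open import Relation.Binary.Definitions using (tri<; tri≈; tri>)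
open import Relation.Binary.PropositionalEquality using (_≢_; refl; sym; trans; cong; cong₂; subst; module ≡-Reasoning)
open import Relation.Nullary using (¬_; Dec; yes; no; does)
open import Relation.Nullary.Decidable using (dec-true; dec-false; _×-dec_)

-- Identities for ⟦_⟧ are transported from ℚᵘ, where they become identities between integer cross products.
⟦⟧≃mkℚᵘ : ∀ z → toℚᵘ ⟦ z ⟧ ≃ᵘ mkℚᵘ z 0
⟦⟧≃mkℚᵘ z = ℚ.toℚᵘ-fromℚᵘ (mkℚᵘ z 0)

⟦⟧-homo-+ : ∀ a b → ⟦ a ℤ.+ b ⟧ ≡ ⟦ a ⟧ ⊕ ⟦ b ⟧
⟦⟧-homo-+ a b = ℚ.toℚᵘ-injective (ℚᵘ.≃-trans (⟦⟧≃mkℚᵘ (a ℤ.+ b)) (ℚᵘ.≃-trans (*≡* cross)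
  (ℚᵘ.≃-sym (ℚᵘ.≃-trans (ℚ.toℚᵘ-homo-+ ⟦ a ⟧ ⟦ b ⟧) (ℚᵘ.+-cong (⟦⟧≃mkℚᵘ a) (⟦⟧≃mkℚᵘ b))))))
  where
  cross : (a ℤ.+ b) ℤ.* + 1 ≡ (a ℤ.* + 1 ℤ.+ b ℤ.* + 1) ℤ.* + 1
  cross = cong (ℤ._* + 1) (sym (cong₂ ℤ._+_ (ℤ.*-identityʳ a) (ℤ.*-identityʳ b)))

⟦⟧-homo-* : ∀ a b → ⟦ a ℤ.* b ⟧ ≡ ⟦ a ⟧ ⊗ ⟦ b ⟧
⟦⟧-homo-* a b = ℚ.toℚᵘ-injective (ℚᵘ.≃-trans (⟦⟧≃mkℚᵘ (a ℤ.* b))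
  (ℚᵘ.≃-sym (ℚᵘ.≃-trans (ℚ.toℚᵘ-homo-* ⟦ a ⟧ ⟦ b ⟧) (ℚᵘ.*-cong (⟦⟧≃mkℚᵘ a) (⟦⟧≃mkℚᵘ b)))))

⟦⟧-homo-- : ∀ a b → ⟦ a - b ⟧ ≡ ⟦ a ⟧ ⊖ ⟦ b ⟧
⟦⟧-homo-- a b = trans (⟦⟧-homo-+ a (ℤ.- b)) (cong (⟦ a ⟧ ⊕_) negation)
  where
  negation : ⟦ ℤ.- b ⟧ ≡ ⊖ ⟦ b ⟧
  negation = ℚ.toℚᵘ-injective (ℚᵘ.≃-trans (⟦⟧≃mkℚᵘ (ℤ.- b))
    (ℚᵘ.≃-sym (ℚᵘ.≃-trans (ℚ.toℚᵘ-homo‿- ⟦ b ⟧) (ℚᵘ.-‿cong (⟦⟧≃mkℚᵘ b)))))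

/-*-cancel : ∀ a k → (a / suc k) ⊗ ⟦ + suc k ⟧ ≡ ⟦ a ⟧
/-*-cancel a k = ℚ.toℚᵘ-injective (ℚᵘ.≃-trans (ℚ.toℚᵘ-homo-* (a / suc k) ⟦ + suc k ⟧)
  (ℚᵘ.≃-trans (ℚᵘ.*-cong (ℚ.toℚᵘ-fromℚᵘ (mkℚᵘ a k)) (⟦⟧≃mkℚᵘ (+ suc k)))
  (ℚᵘ.≃-trans (*≡* cross) (ℚᵘ.≃-sym (⟦⟧≃mkℚᵘ a)))))
  where
  cross : (a ℤ.* + suc k) ℤ.* + 1 ≡ a ℤ.* + (suc k ℕ.* 1)
  cross = trans (ℤ.*-identityʳ _) (cong (λ m → a ℤ.* + m) (sym (ℕ.*-identityʳ (suc k))))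

ι : ℕ → ℚ
ι n = ⟦ + n ⟧

ι-homo-+ : ∀ a b → ι (a + b) ≡ ι a ⊕ ι b
ι-homo-+ a b = trans (cong ⟦_⟧ (ℤ.pos-+ a b)) (⟦⟧-homo-+ (+ a) (+ b))

ι-homo-* : ∀ a b → ι (a * b) ≡ ι a ⊗ ι b
ι-homo-* a b = trans (cong ⟦_⟧ (ℤ.pos-* a b)) (⟦⟧-homo-* (+ a) (+ b))

ι-suc : ∀ n → ι (suc n) ≡ 1ℚ ⊕ ι n
ι-suc = ι-homo-+ 1

sum1-cong : ∀ n {f g : ℕ → ℚ} → (∀ k → 1 ≤ k → k ≤ n → f k ≡ g k) → sum1 n f ≡ sum1 n g
sum1-cong zero    h = refl
sum1-cong (suc n) h = cong₂ _⊕_ (sum1-cong n (λ k 1≤k k≤n → h k 1≤k (ℕ.m≤n⇒m≤1+n k≤n))) (h (suc n) (s≤s z≤n) ℕ.≤-refl)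

sum1-zeros : ∀ n {f : ℕ → ℚ} → (∀ k → 1 ≤ k → k ≤ n → f k ≡ 0ℚ) → sum1 n f ≡ 0ℚ
sum1-zeros n h = trans (sum1-cong n h) (zeros n)
  where
  zeros : ∀ n → sum1 n (λ _ → 0ℚ) ≡ 0ℚ
  zeros zero    = refl
  zeros (suc n) = trans (ℚ.+-identityʳ _) (zeros n)

sum1-distrib-⊕ : ∀ n (f g : ℕ → ℚ) → sum1 n (λ k → f k ⊕ g k) ≡ sum1 n f ⊕ sum1 n g
sum1-distrib-⊕ zero    f g = refl
sum1-distrib-⊕ (suc n) f g =
  trans (cong (_⊕ (f (suc n) ⊕ g (suc n))) (sum1-distrib-⊕ n f g)) (+-interchange (sum1 n f) (sum1 n g) (f (suc n)) (g (suc n)))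
  where
  open ℚ-Solver using (solve; _:+_; _:=_)
  +-interchange : ∀ a b c d → (a ⊕ b) ⊕ (c ⊕ d) ≡ (a ⊕ c) ⊕ (b ⊕ d)
  +-interchange = solve 4 (λ a b c d → (a :+ b) :+ (c :+ d) := (a :+ c) :+ (b :+ d)) refl

*-distribˡ-sum1 : ∀ n c (f : ℕ → ℚ) → c ⊗ sum1 n f ≡ sum1 n (λ k → c ⊗ f k)
*-distribˡ-sum1 zero    c f = ℚ.*-zeroʳ c
*-distribˡ-sum1 (suc n) c f = trans (ℚ.*-distribˡ-+ c _ _) (cong (_⊕ (c ⊗ f (suc n))) (*-distribˡ-sum1 n c f))

*-distribʳ-sum1 : ∀ n c (f : ℕ → ℚ) → sum1 n f ⊗ c ≡ sum1 n (λ k → f k ⊗ c)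
*-distribʳ-sum1 n c f = trans (ℚ.*-comm _ c) (trans (*-distribˡ-sum1 n c f) (sum1-cong n (λ k _ _ → ℚ.*-comm c (f k))))

neg-distrib-sum1 : ∀ n (f : ℕ → ℚ) → ⊖ sum1 n f ≡ sum1 n (λ k → ⊖ f k)
neg-distrib-sum1 zero    f = refl
neg-distrib-sum1 (suc n) f = trans (ℚ.neg-distrib-+ (sum1 n f) (f (suc n))) (cong (_⊖ f (suc n)) (neg-distrib-sum1 n f))

sum1-comm : ∀ n m (F : ℕ → ℕ → ℚ) → sum1 n (λ i → sum1 m (F i)) ≡ sum1 m (λ j → sum1 n (λ i → F i j))
sum1-comm zero    m F = sym (sum1-zeros m (λ _ _ _ → refl))
sum1-comm (suc n) m F =
  trans (cong (_⊕ sum1 m (F (suc n))) (sum1-comm n m F)) (sym (sum1-distrib-⊕ m (λ j → sum1 n (λ i → F i j)) (F (suc n))))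

sum1-single : ∀ n a (f : ℕ → ℚ) → 1 ≤ a → a ≤ n → (∀ k → 1 ≤ k → k ≤ n → k ≢ a → f k ≡ 0ℚ) → sum1 n f ≡ f a
sum1-single zero    zero f () _ _
sum1-single (suc n) a f 1≤a a≤1+n h with ℕ.m≤n⇒m<n∨m≡n a≤1+n
... | inj₂ refl = trans (cong (_⊕ f (suc n)) (sum1-zeros n (λ k 1≤k k≤n → h k 1≤k (ℕ.m≤n⇒m≤1+n k≤n) (ℕ.<⇒≢ (s≤s k≤n)))))
                        (ℚ.+-identityˡ _)
... | inj₁ (s≤s a≤n) = trans (cong₂ _⊕_ (sum1-single n a f 1≤a a≤n (λ k 1≤k k≤n → h k 1≤k (ℕ.m≤n⇒m≤1+n k≤n)))
                                       (h (suc n) (s≤s z≤n) ℕ.≤-refl (ℕ.<⇒≢ (s≤s a≤n) ∘ sym)))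
                             (ℚ.+-identityʳ _)

sum₀ : ℕ → (ℕ → ℚ) → ℚ
sum₀ k f = sum1 (suc k) (f ∘ pred)

sum₀-cong : ∀ k {f g : ℕ → ℚ} → (∀ i → i ≤ k → f i ≡ g i) → sum₀ k f ≡ sum₀ k g
sum₀-cong k h = sum1-cong (suc k) (λ { (suc i) _ (s≤s i≤k) → h i i≤k })

sum₀-zeros : ∀ k {f : ℕ → ℚ} → (∀ i → i ≤ k → f i ≡ 0ℚ) → sum₀ k f ≡ 0ℚ
sum₀-zeros k h = sum1-zeros (suc k) (λ { (suc i) _ (s≤s i≤k) → h i i≤k })

sum₀-first-three : ∀ r (h : ℕ → ℚ) → (∀ i → 3 ≤ i → i ≤ suc (suc r) → h i ≡ 0ℚ) →
                   sum₀ (suc (suc r)) h ≡ 0ℚ ⊕ h 0 ⊕ h 1 ⊕ h 2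
sum₀-first-three zero    h _   = refl
sum₀-first-three (suc r) h h≡0 =
  trans (cong₂ _⊕_ (sum₀-first-three r h (λ i 3≤i i≤r+2 → h≡0 i 3≤i (ℕ.m≤n⇒m≤1+n i≤r+2)))
                   (h≡0 (3 + r) (s≤s (s≤s (s≤s z≤n))) ℕ.≤-refl))
        (ℚ.+-identityʳ _)

if-*ˡ : ∀ b A c → c ⊗ (if b then A else 0ℚ) ≡ (if b then c ⊗ A else 0ℚ)
if-*ˡ true  A c = refl
if-*ˡ false A c = ℚ.*-zeroʳ c

if-*ʳ : ∀ b A c → (if b then A else 0ℚ) ⊗ c ≡ (if b then A ⊗ c else 0ℚ)
if-*ʳ true  A c = refl
if-*ʳ false A c = ℚ.*-zeroˡ c

if-⊖ : ∀ b A B → (if b then A else 0ℚ) ⊖ (if b then B else 0ℚ) ≡ (if b then A ⊖ B else 0ℚ)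
if-⊖ true  A B = refl
if-⊖ false A B = refl

if-0 : ∀ b → (if b then 0ℚ else 0ℚ) ≡ 0ℚ
if-0 true  = refl
if-0 false = refl

if-yes : ∀ {P : Set} (P? : Dec P) {A : ℚ} → P → (if does P? then A else 0ℚ) ≡ A
if-yes P? {A} p = cong (λ b → if b then A else 0ℚ) (dec-true P? p)

if-no : ∀ {P : Set} (P? : Dec P) {A : ℚ} → ¬ P → (if does P? then A else 0ℚ) ≡ 0ℚ
if-no P? {A} ¬p = cong (λ b → if b then A else 0ℚ) (dec-false P? ¬p)

if-cong : ∀ {P : Set} (P? : Dec P) {A B : ℚ} → (P → A ≡ B) →
          (if does P? then A else 0ℚ) ≡ (if does P? then B else 0ℚ)
if-cong (yes p) A≡B = A≡B p
if-cong (no  _) A≡B = refl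

if-distrib-sum1 : ∀ b n (f : ℕ → ℚ) → (if b then sum1 n f else 0ℚ) ≡ sum1 n (λ k → if b then f k else 0ℚ)
if-distrib-sum1 true  n f = refl
if-distrib-sum1 false n f = sym (sum1-zeros n (λ _ _ _ → refl))

prime⇒>1 : ∀ {p} → Prime p → 1 < p
prime⇒>1 {suc (suc _)} _ = s≤s (s≤s z≤n)

1≤m*n : ∀ {m n} → 1 ≤ m → 1 ≤ n → 1 ≤ m * n
1≤m*n {suc m} {suc n} _ _ = s≤s z≤n

*-<-if-≢ : ∀ {a b m n} → a ≤ m → b ≤ n → 1 ≤ a → 1 ≤ n → a ≢ m ⊎ b ≢ n → a * b < m * n
*-<-if-≢ {a} {b} {m} {n} a≤m b≤n 1≤a 1≤n (inj₁ a≢m) =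
  ℕ.≤-<-trans (ℕ.*-monoʳ-≤ a b≤n) (ℕ.*-monoˡ-< n {{ℕ.>-nonZero 1≤n}} (ℕ.≤∧≢⇒< a≤m a≢m))
*-<-if-≢ {a} {b} {m} {n} a≤m b≤n 1≤a 1≤n (inj₂ b≢n) =
  ℕ.<-≤-trans (ℕ.*-monoʳ-< a {{ℕ.>-nonZero 1≤a}} (ℕ.≤∧≢⇒< b≤n b≢n)) (ℕ.*-monoˡ-≤ n a≤m)

divisor-≥1 : ∀ {d n} → 1 ≤ n → d ∣ n → 1 ≤ d
divisor-≥1 {zero}  {suc n} _ (divides q eq) = ⊥-elim (ℕ.1+n≢0 (trans eq (ℕ.*-zeroʳ q)))
divisor-≥1 {suc d}         _ _             = s≤s z≤n

divisor-≤ : ∀ {d n} → 1 ≤ n → d ∣ n → d ≤ n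
divisor-≤ 1≤n = ∣⇒≤ {{ℕ.>-nonZero 1≤n}}

factors-∣ : ∀ {d e n} → d * e ≡ n → d ∣ n × e ∣ n
factors-∣ {d} {e} de≡n = divides e (trans (sym de≡n) (ℕ.*-comm d e)) , divides d (sym de≡n)

coprime-divisors : ∀ {m n d₁ d₂} → Coprime m n → d₁ ∣ m → d₂ ∣ n → Coprime d₁ d₂
coprime-divisors cop d₁∣m d₂∣n (c∣d₁ , c∣d₂) = cop (∣-trans c∣d₁ d₁∣m , ∣-trans c∣d₂ d₂∣n)

coprime-divisor-split : ∀ {m n d} → Coprime m n → d ∣ m * n → d ≡ gcd d m * gcd d n
coprime-divisor-split {m} {n} {d} cop d∣mn = ∣-antisym d∣ab ab∣d
  where
  a = gcd d m
  b = gcd d n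
  ab∣d : a * b ∣ d
  ab∣d with gcd[m,n]∣m d m
  ... | divides q d≡qa = subst (a * b ∣_) (trans (ℕ.*-comm a q) (sym d≡qa)) (*-monoʳ-∣ a b∣q)
    where
    b∣aq : b ∣ a * q
    b∣aq = subst (b ∣_) (trans d≡qa (ℕ.*-comm q a)) (gcd[m,n]∣m d n)
    b∣q : b ∣ q
    b∣q = Coprime.coprime-divisor (Coprime.sym (coprime-divisors cop (gcd[m,n]∣n d m) (gcd[m,n]∣n d n))) b∣aq
  d∣na : d ∣ n * a
  d∣na = subst (d ∣_) (sym (c*gcd[m,n]≡gcd[cm,cn] n d m))
           (gcd-greatest (∣n⇒∣m*n n ∣-refl) (subst (d ∣_) (ℕ.*-comm m n) d∣mn))
  d∣ab : d ∣ a * b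
  d∣ab = subst (d ∣_) (trans (sym (c*gcd[m,n]≡gcd[cm,cn] a n d)) (cong (a *_) (gcd-comm n d)))
           (gcd-greatest (subst (d ∣_) (ℕ.*-comm n a) d∣na) (∣n⇒∣m*n a ∣-refl))

gcd[d₁*d₂,m]≡d₁ : ∀ {m n d₁ d₂} → Coprime m n → d₁ ∣ m → d₂ ∣ n → gcd (d₁ * d₂) m ≡ d₁
gcd[d₁*d₂,m]≡d₁ {m} {n} {d₁} {d₂} cop d₁∣m d₂∣n = ∣-antisym g∣d₁ (gcd-greatest (∣m⇒∣m*n d₂ ∣-refl) d₁∣m)
  where
  g = gcd (d₁ * d₂) m
  g∣d₁ : g ∣ d₁
  g∣d₁ = Coprime.coprime-divisor (coprime-divisors cop (gcd[m,n]∣n (d₁ * d₂) m) d₂∣n)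
           (subst (g ∣_) (ℕ.*-comm d₁ d₂) (gcd[m,n]∣m (d₁ * d₂) m))

gcd[d₁*d₂,n]≡d₂ : ∀ {m n d₁ d₂} → Coprime m n → d₁ ∣ m → d₂ ∣ n → gcd (d₁ * d₂) n ≡ d₂
gcd[d₁*d₂,n]≡d₂ {n = n} {d₁} {d₂} cop d₁∣m d₂∣n =
  trans (cong (λ x → gcd x n) (ℕ.*-comm d₁ d₂)) (gcd[d₁*d₂,m]≡d₁ (Coprime.sym cop) d₂∣n d₁∣m)

prime∤⇒coprime : ∀ {p d} → Prime p → ¬ (p ∣ d) → Coprime p d
prime∤⇒coprime pp p∤d (c∣p , c∣d) with prime⇒irreducible pp c∣p
... | inj₁ c≡1    = c≡1
... | inj₂ refl   = ⊥-elim (p∤d c∣d)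

∣p^k⇒≡p^i : ∀ {p d} k → Prime p → d ∣ p ^ k → ∃ λ i → i ≤ k × d ≡ p ^ i
∣p^k⇒≡p^i zero pp d∣1 = 0 , z≤n , ∣1⇒≡1 d∣1
∣p^k⇒≡p^i {p} {d} (suc k) pp d∣p^k+1 with p ∣? d
... | no p∤d with ∣p^k⇒≡p^i k pp (Coprime.coprime-divisor (Coprime.sym (prime∤⇒coprime pp p∤d)) d∣p^k+1)
...   | i , i≤k , d≡p^i = i , ℕ.m≤n⇒m≤1+n i≤k , d≡p^i
∣p^k⇒≡p^i {p} {d} (suc k) pp d∣p^k+1 | yes (divides q refl)
  with ∣p^k⇒≡p^i k pp (*-cancelˡ-∣ p {{prime⇒nonZero pp}} (subst (_∣ p * p ^ k) (ℕ.*-comm q p) d∣p^k+1))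
... | i , i≤k , refl = suc i , s≤s i≤k , ℕ.*-comm (p ^ i) p

^-injective : ∀ {p} → 1 < p → ∀ i j → p ^ i ≡ p ^ j → i ≡ j
^-injective {p} 1<p i j p^i≡p^j with ℕ.<-cmp i j
... | tri< i<j _ _ = ⊥-elim (ℕ.<⇒≢ (ℕ.^-monoʳ-< p 1<p i<j) p^i≡p^j)
... | tri≈ _ i≡j _ = i≡j
... | tri> _ _ i>j = ⊥-elim (ℕ.<⇒≢ (ℕ.^-monoʳ-< p 1<p i>j) (sym p^i≡p^j))

prime-power-coprime : ∀ {p m} k → Prime p → ¬ (p ∣ m) → Coprime (p ^ k) m
prime-power-coprime k pp p∤m (c∣p^k , c∣m) with ∣p^k⇒≡p^i k pp c∣p^k
... | zero  , _ , c≡1 = c≡1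
... | suc i , _ , refl = ⊥-elim (p∤m (∣-trans (m∣m*n _) c∣m))

prime∣p^k⇒≡p : ∀ {p q} k → Prime p → Prime q → q ∣ p ^ k → q ≡ p
prime∣p^k⇒≡p {p} {q} k pp pq q∣p^k with ∣p^k⇒≡p^i k pp q∣p^k
... | zero  , _ , refl = ⊥-elim (ℕ.<-irrefl refl (prime⇒>1 pq))
... | suc i , _ , refl with prime⇒irreducible pq (m∣m*n {p} (p ^ i))
...   | inj₁ p≡1 = ⊥-elim (ℕ.<⇒≢ (prime⇒>1 pp) (sym p≡1))
...   | inj₂ p≡q = sym p≡q

prime-factor : ∀ n → 1 < n → ∃ λ p → Prime p × p ∣ n
prime-factor n 1<n with factorise n {{ℕ.>-nonZero (ℕ.<-trans (s≤s z≤n) 1<n)}}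
... | record { factors = [] ; isFactorisation = n≡1 } = ⊥-elim (ℕ.<⇒≢ 1<n (sym n≡1))
... | record { factors = p ∷ _ ; isFactorisation = eq ; factorsPrime = pp ∷ _ } =
  p , pp , subst (p ∣_) (sym eq) (m∣m*n _)

factor-out-prime : ∀ {p} → Prime p → ∀ n → 1 ≤ n → ∃ λ k → ∃ λ m → n ≡ p ^ k * m × ¬ (p ∣ m)
factor-out-prime {p} pp = <-rec _ split
  where
  split : ∀ n → (∀ {q} → q < n → 1 ≤ q → ∃ λ k → ∃ λ m → q ≡ p ^ k * m × ¬ (p ∣ m)) →
          1 ≤ n → ∃ λ k → ∃ λ m → n ≡ p ^ k * m × ¬ (p ∣ m)
  split n rec 1≤n with p ∣? n
  ... | no p∤n = 0 , n , sym (ℕ.+-identityʳ n) , p∤n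
  ... | yes (divides q refl) with rec q<q*p 1≤q
    where
    1≤q : 1 ≤ q
    1≤q = ℕ.n≢0⇒n>0 (λ q≡0 → ℕ.<⇒≢ 1≤n (sym (cong (_* p) q≡0)))
    q<q*p : q < q * p
    q<q*p = subst (_< q * p) (ℕ.*-identityʳ q) (ℕ.*-monoʳ-< q {{ℕ.>-nonZero 1≤q}} (prime⇒>1 pp))
  ... | k , m , refl , p∤m = suc k , m , reassoc , p∤m
    where
    reassoc : p ^ k * m * p ≡ p * p ^ k * m
    reassoc = trans (ℕ.*-comm (p ^ k * m) p) (sym (ℕ.*-assoc p (p ^ k) m))

IsSquare : ℕ → Set
IsSquare n = ∃ λ x → x * x ≡ n

coprime-product-square : ∀ {m n} → Coprime m n → 1 ≤ m → IsSquare (m * n) → IsSquare m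
coprime-product-square {m} {n} cop 1≤m (x , xx≡mn) = a , ∣-antisym aa∣m m∣aa
  where
  a = gcd m x
  a∣m = gcd[m,n]∣m m x
  a∣x = gcd[m,n]∣n m x
  aa∣m : a * a ∣ m
  aa∣m with a∣m
  ... | divides q m≡qa = subst (a * a ∣_) (trans (ℕ.*-comm a q) (sym m≡qa)) (*-monoʳ-∣ a a∣q)
    where
    aa∣a[qn] : a * a ∣ a * (q * n)
    aa∣a[qn] = subst (a * a ∣_)
      (trans xx≡mn (trans (cong (_* n) (trans m≡qa (ℕ.*-comm q a))) (ℕ.*-assoc a q n)))
      (*-pres-∣ a∣x a∣x)
    a∣nq : a ∣ n * q
    a∣nq = subst (a ∣_) (ℕ.*-comm q n) (*-cancelˡ-∣ a {{ℕ.>-nonZero (divisor-≥1 1≤m a∣m)}} aa∣a[qn])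
    a∣q : a ∣ q
    a∣q = Coprime.coprime-divisor (coprime-divisors cop a∣m ∣-refl) a∣nq
  m∣xa : m ∣ x * a
  m∣xa = subst (m ∣_) (sym (c*gcd[m,n]≡gcd[cm,cn] x m x))
           (gcd-greatest (n∣m*n x) (subst (m ∣_) (sym xx≡mn) (m∣m*n n)))
  m∣aa : m ∣ a * a
  m∣aa = subst (m ∣_) (sym (c*gcd[m,n]≡gcd[cm,cn] a m x))
           (gcd-greatest (n∣m*n a) (subst (m ∣_) (ℕ.*-comm x a) m∣xa))

cofactorSum : ℕ → ℕ → ℕ → (ℕ → ℚ) → ℚ
cofactorSum N d n F = sum1 N (λ e → if does (d * e ≟ n) then F e else 0ℚ)

-- (f ⋆ g) N is definitionally pairSum N (λ d e → f d ⊗ g e).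
pairSum : ℕ → (ℕ → ℕ → ℚ) → ℚ
pairSum N F = sum1 N (λ d → cofactorSum N d N (F d))

cofactorSum-single : ∀ N {d n q} (F : ℕ → ℚ) → 1 ≤ d → d * q ≡ n → 1 ≤ q → q ≤ N → cofactorSum N d n F ≡ F q
cofactorSum-single N {d} {n} {q} F 1≤d dq≡n 1≤q q≤N =
  trans (sum1-single N q _ 1≤q q≤N (λ e _ _ e≢q → if-no (d * e ≟ n) (e≢q ∘ cancel e)))
        (if-yes (d * q ≟ n) dq≡n)
  where
  cancel : ∀ e → d * e ≡ n → e ≡ q
  cancel e de≡n = ℕ.*-cancelˡ-≡ e q d {{ℕ.>-nonZero 1≤d}} (trans de≡n (sym dq≡n))

cofactorSum-∤ : ∀ N {d n} (F : ℕ → ℚ) → ¬ (d ∣ n) → cofactorSum N d n F ≡ 0ℚ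
cofactorSum-∤ N {d} {n} F d∤n = sum1-zeros N (λ e _ _ → if-no (d * e ≟ n) (d∤n ∘ proj₁ ∘ factors-∣))

cofactorSum-∣ : ∀ {d N} (F : ℕ → ℚ) → 1 ≤ N → (d∣N : d ∣ N) → cofactorSum N d N F ≡ F (quotient d∣N)
cofactorSum-∣ F 1≤N d∣N@(divides q N≡qd) =
  cofactorSum-single _ F (divisor-≥1 1≤N d∣N) (trans (ℕ.*-comm _ q) (sym N≡qd))
    (divisor-≥1 1≤N (quotient-∣ d∣N)) (divisor-≤ 1≤N (quotient-∣ d∣N))

pairSum-cong : ∀ N {F G : ℕ → ℕ → ℚ} → (∀ d e → d * e ≡ N → F d e ≡ G d e) → pairSum N F ≡ pairSum N G
pairSum-cong N F≡G = sum1-cong N (λ d _ _ → sum1-cong N (λ e _ _ → if-cong (d * e ≟ N) (F≡G d e)))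

pairSum-zeros : ∀ N (F : ℕ → ℕ → ℚ) → (∀ d e → d * e ≡ N → F d e ≡ 0ℚ) → pairSum N F ≡ 0ℚ
pairSum-zeros N F F≡0 =
  trans (pairSum-cong N F≡0) (sum1-zeros N (λ d _ _ → sum1-zeros N (λ e _ _ → if-0 (does (d * e ≟ N)))))

pairSum-single : ∀ N (F : ℕ → ℕ → ℚ) → 1 ≤ N → (∀ d e → d * e ≡ N → d ≢ N → F d e ≡ 0ℚ) → pairSum N F ≡ F N 1
pairSum-single N F 1≤N F≡0 =
  trans (sum1-single N N _ 1≤N ℕ.≤-refl (λ d _ _ d≢N → sum1-zeros N (λ e _ _ →
           trans (if-cong (d * e ≟ N) (λ de≡N → F≡0 d e de≡N d≢N)) (if-0 (does (d * e ≟ N))))))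
        (cofactorSum-single N (F N) 1≤N (ℕ.*-identityʳ N) ℕ.≤-refl 1≤N)

*-distribˡ-pairSum : ∀ N c (F : ℕ → ℕ → ℚ) → c ⊗ pairSum N F ≡ pairSum N (λ d e → c ⊗ F d e)
*-distribˡ-pairSum N c F = trans (*-distribˡ-sum1 N c _) (sum1-cong N (λ d _ _ →
  trans (*-distribˡ-sum1 N c _) (sum1-cong N (λ e _ _ → if-*ˡ (does (d * e ≟ N)) (F d e) c))))

*-distribʳ-pairSum : ∀ N c (F : ℕ → ℕ → ℚ) → pairSum N F ⊗ c ≡ pairSum N (λ d e → F d e ⊗ c)
*-distribʳ-pairSum N c F = trans (*-distribʳ-sum1 N c _) (sum1-cong N (λ d _ _ →
  trans (*-distribʳ-sum1 N c _) (sum1-cong N (λ e _ _ → if-*ʳ (does (d * e ≟ N)) (F d e) c))))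

pairSum-distrib-⊖ : ∀ N (F G : ℕ → ℕ → ℚ) → pairSum N F ⊖ pairSum N G ≡ pairSum N (λ d e → F d e ⊖ G d e)
pairSum-distrib-⊖ N F G = sum1-⊖ N (λ d _ _ → sum1-⊖ N (λ e _ _ → if-⊖ (does (d * e ≟ N)) (F d e) (G d e)))
  where
  sum1-⊖ : ∀ n {f g h : ℕ → ℚ} → (∀ k → 1 ≤ k → k ≤ n → f k ⊖ g k ≡ h k) → sum1 n f ⊖ sum1 n g ≡ sum1 n h
  sum1-⊖ n {f} {g} fg≡h = trans (cong (sum1 n f ⊕_) (neg-distrib-sum1 n g))
    (trans (sym (sum1-distrib-⊕ n f (λ k → ⊖ g k))) (sum1-cong n fg≡h))

sum1-divisors-coprime : ∀ {m n} → 1 ≤ m → 1 ≤ n → Coprime m n → (G : ℕ → ℚ) → (∀ d → ¬ (d ∣ m * n) → G d ≡ 0ℚ) →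
  sum1 (m * n) G ≡ sum1 m (λ d₁ → sum1 n (λ d₂ → if does (d₁ ∣? m ×-dec d₂ ∣? n) then G (d₁ * d₂) else 0ℚ))
sum1-divisors-coprime {m} {n} 1≤m 1≤n cop G G≡0 = begin
    sum1 (m * n) G
  ≡⟨ sum1-cong (m * n) (λ d _ _ → split d) ⟩
    sum1 (m * n) (λ d → sum1 m (λ d₁ → sum1 n (λ d₂ → term d₁ d₂ d)))
  ≡⟨ sum1-comm (m * n) m _ ⟩
    sum1 m (λ d₁ → sum1 (m * n) (λ d → sum1 n (λ d₂ → term d₁ d₂ d)))
  ≡⟨ sum1-cong m (λ d₁ _ _ → sum1-comm (m * n) n _) ⟩
    sum1 m (λ d₁ → sum1 n (λ d₂ → sum1 (m * n) (term d₁ d₂)))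
  ≡⟨ sum1-cong m (λ d₁ 1≤d₁ d₁≤m → sum1-cong n (λ d₂ 1≤d₂ d₂≤n → collapse 1≤d₁ d₁≤m 1≤d₂ d₂≤n)) ⟩
    sum1 m (λ d₁ → sum1 n (H d₁))
  ∎
  where
  open ≡-Reasoning
  H : ℕ → ℕ → ℚ
  H d₁ d₂ = if does (d₁ ∣? m ×-dec d₂ ∣? n) then G (d₁ * d₂) else 0ℚ
  term : ℕ → ℕ → ℕ → ℚ
  term d₁ d₂ d = if does (d₁ * d₂ ≟ d) then H d₁ d₂ else 0ℚ

  term-vanishes : ∀ d₁ d₂ d → (d₁ ∣ m → d₂ ∣ n → d₁ * d₂ ≢ d) → term d₁ d₂ d ≡ 0ℚ
  term-vanishes d₁ d₂ d ≢d =
    trans (if-cong (d₁ * d₂ ≟ d) (λ ≡d → if-no (d₁ ∣? m ×-dec d₂ ∣? n) (λ (d₁∣m , d₂∣n) → ≢d d₁∣m d₂∣n ≡d)))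
          (if-0 (does (d₁ * d₂ ≟ d)))

  -- For d ∣ m n the only contributing pair is (gcd d m , gcd d n).
  split : ∀ d → G d ≡ sum1 m (λ d₁ → sum1 n (λ d₂ → term d₁ d₂ d))
  split d with d ∣? m * n
  ... | no d∤mn = trans (G≡0 d d∤mn) (sym (sum1-zeros m (λ d₁ _ _ → sum1-zeros n (λ d₂ _ _ →
                    term-vanishes d₁ d₂ d (λ d₁∣m d₂∣n ≡d → d∤mn (subst (_∣ m * n) ≡d (*-pres-∣ d₁∣m d₂∣n)))))))
  ... | yes d∣mn = sym (begin
      sum1 m (λ d₁ → sum1 n (λ d₂ → term d₁ d₂ d))
    ≡⟨ sum1-single m a _ (divisor-≥1 1≤m a∣m) (divisor-≤ 1≤m a∣m) (λ d₁ _ _ d₁≢a → sum1-zeros n (λ d₂ _ _ →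
         term-vanishes d₁ d₂ d (λ d₁∣m d₂∣n ≡d →
           d₁≢a (trans (sym (gcd[d₁*d₂,m]≡d₁ cop d₁∣m d₂∣n)) (cong (λ x → gcd x m) ≡d))))) ⟩
      sum1 n (λ d₂ → term a d₂ d)
    ≡⟨ sum1-single n b _ (divisor-≥1 1≤n b∣n) (divisor-≤ 1≤n b∣n) (λ d₂ _ _ d₂≢b →
         term-vanishes a d₂ d (λ a∣m d₂∣n ≡d →
           d₂≢b (trans (sym (gcd[d₁*d₂,n]≡d₂ cop a∣m d₂∣n)) (cong (λ x → gcd x n) ≡d)))) ⟩
      term a b d
    ≡⟨ if-yes (a * b ≟ d) (sym d≡ab) ⟩
      H a b
    ≡⟨ if-yes (a ∣? m ×-dec b ∣? n) (a∣m , b∣n) ⟩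
      G (a * b)
    ≡⟨ cong G (sym d≡ab) ⟩
      G d
    ∎)
    where
    a = gcd d m
    b = gcd d n
    a∣m = gcd[m,n]∣n d m
    b∣n = gcd[m,n]∣n d n
    d≡ab = coprime-divisor-split cop d∣mn

  collapse : ∀ {d₁ d₂} → 1 ≤ d₁ → d₁ ≤ m → 1 ≤ d₂ → d₂ ≤ n → sum1 (m * n) (term d₁ d₂) ≡ H d₁ d₂
  collapse {d₁} {d₂} 1≤d₁ d₁≤m 1≤d₂ d₂≤n =
    trans (sum1-single (m * n) (d₁ * d₂) _ (1≤m*n 1≤d₁ 1≤d₂) (ℕ.*-mono-≤ d₁≤m d₂≤n)
                       (λ d _ _ d≢d₁d₂ → if-no (d₁ * d₂ ≟ d) (d≢d₁d₂ ∘ sym)))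
          (if-yes (d₁ * d₂ ≟ d₁ * d₂) refl)

pairSum-coprime : ∀ {m n} → 1 ≤ m → 1 ≤ n → Coprime m n → (F : ℕ → ℕ → ℚ) →
  pairSum (m * n) F ≡ pairSum m (λ d₁ e₁ → pairSum n (λ d₂ e₂ → F (d₁ * d₂) (e₁ * e₂)))
pairSum-coprime {m} {n} 1≤m 1≤n cop F = begin
    pairSum (m * n) F
  ≡⟨ sum1-divisors-coprime 1≤m 1≤n cop _ (λ d → cofactorSum-∤ (m * n) (F d)) ⟩
    sum1 m (λ d₁ → sum1 n (λ d₂ →
      if does (d₁ ∣? m ×-dec d₂ ∣? n) then cofactorSum (m * n) (d₁ * d₂) (m * n) (F (d₁ * d₂)) else 0ℚ))
  ≡⟨ sum1-cong m (λ d₁ _ _ → sum1-cong n (λ d₂ _ _ → unnest d₁ d₂)) ⟩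
    sum1 m (λ d₁ → sum1 n (λ d₂ → cofactorSum m d₁ m (λ e₁ → cofactorSum n d₂ n (λ e₂ → F (d₁ * d₂) (e₁ * e₂)))))
  ≡⟨ sum1-cong m (λ d₁ _ _ → sym (sum1-comm m n _)) ⟩
    sum1 m (λ d₁ → sum1 m (λ e₁ → sum1 n (λ d₂ →
      if does (d₁ * e₁ ≟ m) then cofactorSum n d₂ n (λ e₂ → F (d₁ * d₂) (e₁ * e₂)) else 0ℚ)))
  ≡⟨ sum1-cong m (λ d₁ _ _ → sum1-cong m (λ e₁ _ _ → sym (if-distrib-sum1 (does (d₁ * e₁ ≟ m)) n _))) ⟩
    pairSum m (λ d₁ e₁ → pairSum n (λ d₂ e₂ → F (d₁ * d₂) (e₁ * e₂)))
  ∎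
  where
  open ≡-Reasoning
  unnest : ∀ d₁ d₂ →
    (if does (d₁ ∣? m ×-dec d₂ ∣? n) then cofactorSum (m * n) (d₁ * d₂) (m * n) (F (d₁ * d₂)) else 0ℚ)
    ≡ cofactorSum m d₁ m (λ e₁ → cofactorSum n d₂ n (λ e₂ → F (d₁ * d₂) (e₁ * e₂)))
  unnest d₁ d₂ with d₁ ∣? m | d₂ ∣? n
  ... | no d₁∤m | _ = sym (cofactorSum-∤ m _ d₁∤m)
  ... | yes d₁∣m | no d₂∤n = sym (trans (cofactorSum-∣ _ 1≤m d₁∣m) (cofactorSum-∤ n _ d₂∤n))
  ... | yes d₁∣m@(divides q₁ m≡q₁d₁) | yes d₂∣n@(divides q₂ n≡q₂d₂) =
    trans (cofactorSum-single (m * n) (F (d₁ * d₂)) (1≤m*n (divisor-≥1 1≤m d₁∣m) (divisor-≥1 1≤n d₂∣n)) d₁d₂q₁q₂≡mn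
            (1≤m*n (divisor-≥1 1≤m (quotient-∣ d₁∣m)) (divisor-≥1 1≤n (quotient-∣ d₂∣n)))
            (ℕ.*-mono-≤ (divisor-≤ 1≤m (quotient-∣ d₁∣m)) (divisor-≤ 1≤n (quotient-∣ d₂∣n))))
          (sym (trans (cofactorSum-∣ _ 1≤m d₁∣m) (cofactorSum-∣ _ 1≤n d₂∣n)))
    where
    open ℕ-Solver using (solve; _:*_; _:=_)
    d₁d₂q₁q₂≡mn : d₁ * d₂ * (q₁ * q₂) ≡ m * n
    d₁d₂q₁q₂≡mn = trans (solve 4 (λ a b c d → (a :* b) :* (c :* d) := (c :* a) :* (d :* b)) refl d₁ d₂ q₁ q₂)
                        (sym (cong₂ _*_ m≡q₁d₁ n≡q₂d₂))

sum1-divisors-prime-power : ∀ {p} k → Prime p → (G : ℕ → ℚ) → (∀ d → ¬ (d ∣ p ^ k) → G d ≡ 0ℚ) →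
  sum1 (p ^ k) G ≡ sum₀ k (λ i → G (p ^ i))
sum1-divisors-prime-power {p} k pp G G≡0 = begin
    sum1 (p ^ k) G
  ≡⟨ sum1-cong (p ^ k) (λ d _ _ → split d) ⟩
    sum1 (p ^ k) (λ d → sum₀ k (λ i → term i d))
  ≡⟨ sum1-comm (p ^ k) (suc k) _ ⟩
    sum₀ k (λ i → sum1 (p ^ k) (term i))
  ≡⟨ sum₀-cong k (λ i i≤k → collapse i≤k) ⟩
    sum₀ k (λ i → G (p ^ i))
  ∎
  where
  open ≡-Reasoning
  instance _ = prime⇒nonZero pp
  term : ℕ → ℕ → ℚ
  term i d = if does (p ^ i ≟ d) then G d else 0ℚ

  split : ∀ d → G d ≡ sum₀ k (λ i → term i d)
  split d with d ∣? p ^ k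
  ... | no d∤p^k = trans (G≡0 d d∤p^k)
         (sym (sum₀-zeros k (λ i _ → trans (if-cong (p ^ i ≟ d) (λ _ → G≡0 d d∤p^k)) (if-0 (does (p ^ i ≟ d))))))
  ... | yes d∣p^k with ∣p^k⇒≡p^i k pp d∣p^k
  ...   | i₀ , i₀≤k , d≡p^i₀ = sym (trans (sum1-single (suc k) (suc i₀) _ (s≤s z≤n) (s≤s i₀≤k) off)
                                           (if-yes (p ^ i₀ ≟ d) (sym d≡p^i₀)))
    where
    off : ∀ j → 1 ≤ j → j ≤ suc k → j ≢ suc i₀ → term (pred j) d ≡ 0ℚ
    off (suc i) _ _ i≢i₀ = if-no (p ^ i ≟ d) (λ p^i≡d → i≢i₀ (cong suc (^-injective (prime⇒>1 pp) i i₀ (trans p^i≡d d≡p^i₀))))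

  collapse : ∀ {i} → i ≤ k → sum1 (p ^ k) (term i) ≡ G (p ^ i)
  collapse {i} i≤k =
    trans (sum1-single (p ^ k) (p ^ i) _ (ℕ.m^n>0 p i) (ℕ.^-monoʳ-≤ p i≤k) (λ d _ _ d≢p^i → if-no (p ^ i ≟ d) (d≢p^i ∘ sym)))
          (if-yes (p ^ i ≟ p ^ i) refl)

pairSum-prime-power : ∀ {p} k → Prime p → (F : ℕ → ℕ → ℚ) → pairSum (p ^ k) F ≡ sum₀ k (λ i → F (p ^ i) (p ^ (k ∸ i)))
pairSum-prime-power {p} k pp F =
  trans (sum1-divisors-prime-power k pp _ (λ d → cofactorSum-∤ (p ^ k) (F d)))
        (sum₀-cong k (λ i i≤k → cofactorSum-single (p ^ k) (F (p ^ i)) (ℕ.m^n>0 p i) (p^i*p^[k∸i]≡p^k i≤k)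
                                  (ℕ.m^n>0 p (k ∸ i)) (ℕ.^-monoʳ-≤ p (ℕ.m∸n≤m k i))))
  where
  instance _ = prime⇒nonZero pp
  p^i*p^[k∸i]≡p^k : ∀ {i} → i ≤ k → p ^ i * p ^ (k ∸ i) ≡ p ^ k
  p^i*p^[k∸i]≡p^k {i} i≤k = trans (sym (ℕ.^-distribˡ-+-* p i (k ∸ i))) (cong (p ^_) (ℕ.m+[n∸m]≡n i≤k))

-- Multiplicative functions

Multiplicative : Arith → Set
Multiplicative f = ∀ m n → 1 ≤ m → 1 ≤ n → Coprime m n → f (m * n) ≡ f m ⊗ f n

multiplicative-resp : ∀ {f g} → (∀ n → 1 ≤ n → f n ≡ g n) → Multiplicative f → Multiplicative g
multiplicative-resp {f} {g} f≡g f-mult m n 1≤m 1≤n cop =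
  trans (sym (f≡g (m * n) (1≤m*n 1≤m 1≤n))) (trans (f-mult m n 1≤m 1≤n cop) (cong₂ _⊗_ (f≡g m 1≤m) (f≡g n 1≤n)))

⋆-product : ∀ (f g : Arith) m n →
  (f ⋆ g) m ⊗ (f ⋆ g) n ≡ pairSum m (λ d₁ e₁ → pairSum n (λ d₂ e₂ → (f d₁ ⊗ g e₁) ⊗ (f d₂ ⊗ g e₂)))
⋆-product f g m n =
  trans (*-distribʳ-pairSum m _ _) (pairSum-cong m (λ d₁ e₁ _ → *-distribˡ-pairSum n (f d₁ ⊗ g e₁) _))

*-interchange : ∀ a b c d → (a ⊗ b) ⊗ (c ⊗ d) ≡ (a ⊗ c) ⊗ (b ⊗ d)
*-interchange = solve 4 (λ a b c d → (a :* b) :* (c :* d) := (a :* c) :* (b :* d)) refl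
  where open ℚ-Solver using (solve; _:*_; _:=_)

⋆-multiplicative : ∀ {f g} → Multiplicative f → Multiplicative g → Multiplicative (f ⋆ g)
⋆-multiplicative {f} {g} f-mult g-mult m n 1≤m 1≤n cop = begin
    (f ⋆ g) (m * n)
  ≡⟨ pairSum-coprime 1≤m 1≤n cop _ ⟩
    pairSum m (λ d₁ e₁ → pairSum n (λ d₂ e₂ → f (d₁ * d₂) ⊗ g (e₁ * e₂)))
  ≡⟨ pairSum-cong m (λ d₁ e₁ d₁e₁≡m → pairSum-cong n (λ d₂ e₂ d₂e₂≡n → factor d₁e₁≡m d₂e₂≡n)) ⟩
    pairSum m (λ d₁ e₁ → pairSum n (λ d₂ e₂ → (f d₁ ⊗ g e₁) ⊗ (f d₂ ⊗ g e₂)))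
  ≡⟨ sym (⋆-product f g m n) ⟩
    (f ⋆ g) m ⊗ (f ⋆ g) n
  ∎
  where
  open ≡-Reasoning
  factor : ∀ {d₁ e₁ d₂ e₂} → d₁ * e₁ ≡ m → d₂ * e₂ ≡ n →
           f (d₁ * d₂) ⊗ g (e₁ * e₂) ≡ (f d₁ ⊗ g e₁) ⊗ (f d₂ ⊗ g e₂)
  factor {d₁} {e₁} {d₂} {e₂} d₁e₁≡m d₂e₂≡n =
    trans (cong₂ _⊗_ (f-mult d₁ d₂ (divisor-≥1 1≤m d₁∣m) (divisor-≥1 1≤n d₂∣n) (coprime-divisors cop d₁∣m d₂∣n))
                     (g-mult e₁ e₂ (divisor-≥1 1≤m e₁∣m) (divisor-≥1 1≤n e₂∣n) (coprime-divisors cop e₁∣m e₂∣n)))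
          (*-interchange (f d₁) (f d₂) (g e₁) (g e₂))
    where
    d₁∣m = proj₁ (factors-∣ {d₁} d₁e₁≡m)
    e₁∣m = proj₂ (factors-∣ {d₁} d₁e₁≡m)
    d₂∣n = proj₁ (factors-∣ {d₂} d₂e₂≡n)
    e₂∣n = proj₂ (factors-∣ {d₂} d₂e₂≡n)

δ : Arith
δ N = if does (N ≟ 1) then 1ℚ else 0ℚ

invFuel-fuel-irrelevant : ∀ f {a b} d → 1 ≤ d → d ≤ a → d ≤ b → invFuel f a d ≡ invFuel f b d
invFuel-fuel-irrelevant f {suc a} {suc b} d 1≤d d≤a d≤b =
  cong (λ X → if does (d ≟ 1) then 1ℚ else ⊖ X) (sum1-cong (d ∸ 1) (λ d′ 1≤d′ d′≤d-1 → sum1-cong d (λ e _ _ →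
    cong (λ y → if does (d′ * e ≟ d) then f e ⊗ y else 0ℚ)
      (invFuel-fuel-irrelevant f {a} {b} d′ 1≤d′ (ℕ.≤-trans d′≤d-1 (ℕ.∸-monoˡ-≤ 1 d≤a))
                                                 (ℕ.≤-trans d′≤d-1 (ℕ.∸-monoˡ-≤ 1 d≤b))))))
invFuel-fuel-irrelevant f {zero}  zero () _ _
invFuel-fuel-irrelevant f {suc a} {zero} zero () _ _

dirichletInverse₁-inverseˡ : ∀ f → f 1 ≡ 1ℚ → ∀ N → 1 ≤ N → (dirichletInverse₁ f ⋆ f) N ≡ δ N
dirichletInverse₁-inverseˡ f f1≡1 1 _ = cong (λ x → 0ℚ ⊕ (0ℚ ⊕ (1ℚ ⊗ x))) f1≡1
dirichletInverse₁-inverseˡ f f1≡1 N@(suc (suc r)) _ = begin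
    (g ⋆ f) N
  ≡⟨ cong₂ _⊕_ proper-divisors
       (cofactorSum-single N {N} {N} {1} (λ e → g N ⊗ f e) (s≤s z≤n) (ℕ.*-identityʳ N) (s≤s z≤n) (s≤s z≤n)) ⟩
    X ⊕ (⊖ X) ⊗ f 1
  ≡⟨ cong (λ y → X ⊕ (⊖ X) ⊗ y) f1≡1 ⟩
    X ⊕ (⊖ X) ⊗ 1ℚ
  ≡⟨ solve 1 (λ x → x :+ (:- x) :* con 1ℚ := con 0ℚ) refl X ⟩
    0ℚ
  ∎
  where
  open ≡-Reasoning
  open ℚ-Solver using (solve; _:+_; _:*_; :-_; _:=_; con)
  g = dirichletInverse₁ f
  X = sum1 (suc r) (λ d → sum1 N (λ e → if does (d * e ≟ N) then f e ⊗ invFuel f (suc r) d else 0ℚ))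
  proper-divisors : sum1 (suc r) (λ d → cofactorSum N d N (λ e → g d ⊗ f e)) ≡ X
  proper-divisors = sum1-cong (suc r) (λ d 1≤d d≤r+1 → sum1-cong N (λ e _ _ →
    cong (λ y → if does (d * e ≟ N) then y else 0ℚ)
      (trans (ℚ.*-comm (g d) (f e)) (cong (f e ⊗_) (invFuel-fuel-irrelevant f d 1≤d ℕ.≤-refl d≤r+1)))))

⋆-coprime-defect : ∀ (f g : Arith) {m n} → 1 ≤ m → 1 ≤ n → Coprime m n →
  (g ⋆ f) (m * n) ⊖ (g ⋆ f) m ⊗ (g ⋆ f) n ≡
  pairSum m (λ d₁ e₁ → pairSum n (λ d₂ e₂ → g (d₁ * d₂) ⊗ f (e₁ * e₂) ⊖ (g d₁ ⊗ f e₁) ⊗ (g d₂ ⊗ f e₂)))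
⋆-coprime-defect f g {m} {n} 1≤m 1≤n cop =
  trans (cong₂ _⊖_ (pairSum-coprime 1≤m 1≤n cop _) (⋆-product g f m n))
        (trans (pairSum-distrib-⊖ m _ _) (pairSum-cong m (λ d₁ e₁ _ → pairSum-distrib-⊖ n _ _)))

-- Strong induction on m n: every term of the defect expansion except the top one (d₁ , d₂) = (m , n) vanishes.
inverse-multiplicative : ∀ {f g} → Multiplicative f → f 1 ≡ 1ℚ → g 1 ≡ 1ℚ →
                         (∀ N → 1 ≤ N → (g ⋆ f) N ≡ δ N) → Multiplicative g
inverse-multiplicative {f} {g} f-mult f1≡1 g1≡1 g⋆f≡δ m n = <-rec P step (m * n) m n refl
  where
  P : ℕ → Set
  P N = ∀ m n → m * n ≡ N → 1 ≤ m → 1 ≤ n → Coprime m n → g (m * n) ≡ g m ⊗ g n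

  D : ℕ → ℕ → ℕ → ℕ → ℚ
  D d₁ e₁ d₂ e₂ = g (d₁ * d₂) ⊗ f (e₁ * e₂) ⊖ (g d₁ ⊗ f e₁) ⊗ (g d₂ ⊗ f e₂)

  step : ∀ N → (∀ {M} → M < N → P M) → P N
  step N ih m n refl 1≤m 1≤n cop with m ≟ 1 | n ≟ 1
  ... | yes refl | _ = trans (cong g (ℕ.*-identityˡ n)) (sym (trans (cong (_⊗ g n) g1≡1) (ℚ.*-identityˡ (g n))))
  ... | no _ | yes refl = trans (cong g (ℕ.*-identityʳ m)) (sym (trans (cong (g m ⊗_) g1≡1) (ℚ.*-identityʳ (g m))))
  ... | no m≢1 | no n≢1 = x∙y⁻¹≈ε⇒x≈y ℚ.+-0-group _ _ (begin
      g (m * n) ⊖ g m ⊗ g n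
    ≡⟨ sym top-term ⟩
      D m 1 n 1
    ≡⟨ sym only-top-term ⟩
      pairSum m (λ d₁ e₁ → pairSum n (D d₁ e₁))
    ≡⟨ sym (⋆-coprime-defect f g 1≤m 1≤n cop) ⟩
      (g ⋆ f) (m * n) ⊖ (g ⋆ f) m ⊗ (g ⋆ f) n
    ≡⟨ cong₂ (λ a b → a ⊖ b ⊗ (g ⋆ f) n)
         (trans (g⋆f≡δ (m * n) (1≤m*n 1≤m 1≤n)) (if-no (m * n ≟ 1) (m≢1 ∘ ℕ.m*n≡1⇒m≡1 m n)))
         (trans (g⋆f≡δ m 1≤m) (if-no (m ≟ 1) m≢1)) ⟩
      0ℚ ⊖ 0ℚ ⊗ (g ⋆ f) n
    ≡⟨ cong (λ x → 0ℚ ⊖ x) (ℚ.*-zeroˡ ((g ⋆ f) n)) ⟩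
      0ℚ
    ∎)
    where
    open ≡-Reasoning
    D-vanishes : ∀ {d₁ e₁ d₂ e₂} → d₁ * e₁ ≡ m → d₂ * e₂ ≡ n → d₁ ≢ m ⊎ d₂ ≢ n → D d₁ e₁ d₂ e₂ ≡ 0ℚ
    D-vanishes {d₁} {e₁} {d₂} {e₂} d₁e₁≡m d₂e₂≡n ≢ =
      trans (cong₂ (λ x y → x ⊗ y ⊖ (g d₁ ⊗ f e₁) ⊗ (g d₂ ⊗ f e₂))
                   (ih (*-<-if-≢ (divisor-≤ 1≤m d₁∣m) (divisor-≤ 1≤n d₂∣n) (divisor-≥1 1≤m d₁∣m) 1≤n ≢)
                       d₁ d₂ refl (divisor-≥1 1≤m d₁∣m) (divisor-≥1 1≤n d₂∣n) (coprime-divisors cop d₁∣m d₂∣n))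
                   (f-mult e₁ e₂ (divisor-≥1 1≤m e₁∣m) (divisor-≥1 1≤n e₂∣n) (coprime-divisors cop e₁∣m e₂∣n)))
            (trans (cong (_⊖ (g d₁ ⊗ f e₁) ⊗ (g d₂ ⊗ f e₂)) (*-interchange (g d₁) (g d₂) (f e₁) (f e₂)))
                   (ℚ.+-inverseʳ ((g d₁ ⊗ f e₁) ⊗ (g d₂ ⊗ f e₂))))
      where
      d₁∣m = proj₁ (factors-∣ {d₁} d₁e₁≡m)
      e₁∣m = proj₂ (factors-∣ {d₁} d₁e₁≡m)
      d₂∣n = proj₁ (factors-∣ {d₂} d₂e₂≡n)
      e₂∣n = proj₂ (factors-∣ {d₂} d₂e₂≡n)

    only-top-term : pairSum m (λ d₁ e₁ → pairSum n (D d₁ e₁)) ≡ D m 1 n 1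
    only-top-term =
      trans (pairSum-single m _ 1≤m (λ d₁ e₁ d₁e₁≡m d₁≢m →
               pairSum-zeros n _ (λ d₂ e₂ d₂e₂≡n → D-vanishes d₁e₁≡m d₂e₂≡n (inj₁ d₁≢m))))
            (pairSum-single n _ 1≤n (λ d₂ e₂ d₂e₂≡n d₂≢n → D-vanishes (ℕ.*-identityʳ m) d₂e₂≡n (inj₂ d₂≢n)))

    top-term : D m 1 n 1 ≡ g (m * n) ⊖ g m ⊗ g n
    top-term = trans (cong (λ y → g (m * n) ⊗ y ⊖ (g m ⊗ y) ⊗ (g n ⊗ y)) f1≡1)
                     (solve 3 (λ x a b → x :* con 1ℚ :- (a :* con 1ℚ) :* (b :* con 1ℚ) := x :- a :* b) refl (g (m * n)) (g m) (g n))
      where open ℚ-Solver using (solve; _:*_; _:-_; _:=_; con)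

multiplicative-≡ : ∀ {f g} → Multiplicative f → Multiplicative g → f 1 ≡ g 1 →
                   (∀ p k → Prime p → 1 ≤ k → f (p ^ k) ≡ g (p ^ k)) → ∀ n → 1 ≤ n → f n ≡ g n
multiplicative-≡ {f} {g} f-mult g-mult f1≡g1 f≡g-on-prime-powers = <-rec _ step
  where
  step : ∀ n → (∀ {m} → m < n → 1 ≤ m → f m ≡ g m) → 1 ≤ n → f n ≡ g n
  step n ih 1≤n with n ≟ 1
  ... | yes refl = f1≡g1
  ... | no n≢1 with prime-factor n (ℕ.≤∧≢⇒< 1≤n (n≢1 ∘ sym))
  ...   | p , pp , p∣n with factor-out-prime pp n 1≤n
  ...     | zero  , m , n≡1*m , p∤m = ⊥-elim (p∤m (subst (p ∣_) (trans n≡1*m (ℕ.*-identityˡ m)) p∣n))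
  ...     | suc k , m , n≡q*m , p∤m = begin
      f n              ≡⟨ cong f n≡q*m ⟩
      f (q * m)        ≡⟨ f-mult q m 1≤q 1≤m cop ⟩
      f q ⊗ f m        ≡⟨ cong₂ _⊗_ (f≡g-on-prime-powers p (suc k) pp (s≤s z≤n)) (ih m<n 1≤m) ⟩
      g q ⊗ g m        ≡⟨ sym (g-mult q m 1≤q 1≤m cop) ⟩
      g (q * m)        ≡⟨ cong g (sym n≡q*m) ⟩
      g n              ∎
    where
    open ≡-Reasoning
    q = p ^ suc k
    1<q : 1 < q
    1<q = ℕ.^-monoʳ-< p (prime⇒>1 pp) {0} {suc k} (s≤s z≤n)
    1≤q : 1 ≤ q
    1≤q = ℕ.<⇒≤ 1<q
    1≤m : 1 ≤ m
    1≤m = ℕ.n≢0⇒n>0 (λ m≡0 → ℕ.<⇒≢ 1≤n (sym (trans n≡q*m (trans (cong (q *_) m≡0) (ℕ.*-zeroʳ q)))))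
    m<n : m < n
    m<n = subst (m <_) (trans (ℕ.*-comm m q) (sym n≡q*m)) (ℕ.m<m*n m q {{ℕ.>-nonZero 1≤m}} 1<q)
    cop : Coprime q m
    cop = prime-power-coprime (suc k) pp p∤m

-- The divisor function and its Dirichlet inverse

one-multiplicative : Multiplicative one
one-multiplicative _ _ _ _ _ = refl

σ₀≡one⋆one : ∀ n → 1 ≤ n → σ₀ n ≡ (one ⋆ one) n
σ₀≡one⋆one n 1≤n = sum1-cong n (λ d _ _ → divisor-indicator d)
  where
  divisor-indicator : ∀ d → (if does (d ∣? n) then 1ℚ else 0ℚ) ≡ cofactorSum n d n (λ _ → 1ℚ)
  divisor-indicator d with d ∣? n
  ... | yes d∣n = sym (cofactorSum-∣ _ 1≤n d∣n)
  ... | no  d∤n = sym (cofactorSum-∤ n _ d∤n)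

σ₀-multiplicative : Multiplicative σ₀
σ₀-multiplicative = multiplicative-resp {one ⋆ one} (λ n 1≤n → sym (σ₀≡one⋆one n 1≤n))
                      (⋆-multiplicative {one} {one} one-multiplicative one-multiplicative)

sum₀-ones : ∀ k → sum₀ k (λ _ → 1ℚ) ≡ ι (suc k)
sum₀-ones zero    = refl
sum₀-ones (suc k) = trans (cong (_⊕ 1ℚ) (sum₀-ones k)) (trans (ℚ.+-comm (ι (suc k)) 1ℚ) (sym (ι-suc (suc k))))

σ₀-prime-power : ∀ {p} k → Prime p → σ₀ (p ^ k) ≡ ι (suc k)
σ₀-prime-power {p} k pp =
  trans (σ₀≡one⋆one (p ^ k) (ℕ.m^n>0 p {{prime⇒nonZero pp}} k)) (trans (pairSum-prime-power k pp _) (sum₀-ones k))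

σ₀⁻¹⋆σ₀≡δ : ∀ N → 1 ≤ N → (σ₀⁻¹ ⋆ σ₀) N ≡ δ N
σ₀⁻¹⋆σ₀≡δ = dirichletInverse₁-inverseˡ σ₀ refl

σ₀⁻¹-multiplicative : Multiplicative σ₀⁻¹
σ₀⁻¹-multiplicative = inverse-multiplicative {σ₀} {σ₀⁻¹} σ₀-multiplicative refl refl σ₀⁻¹⋆σ₀≡δ

last-term : ∀ a x → a ⊕ x ⊗ 1ℚ ≡ 0ℚ → x ≡ ⊖ a
last-term a x a+x≡0 = trans (solve 2 (λ a x → x := (:- a) :+ (a :+ x :* con 1ℚ)) refl a x)
                            (trans (cong (⊖ a ⊕_) a+x≡0) (ℚ.+-identityʳ (⊖ a)))
  where open ℚ-Solver using (solve; _:+_; _:*_; :-_; _:=_; con)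

module DivisorInverseAtPrimePowers {p} (pp : Prime p) where

  private instance _ = prime⇒nonZero pp

  s : ℕ → ℚ
  s k = σ₀⁻¹ (p ^ k)

  recurrence : ∀ k → sum₀ k (λ i → s i ⊗ ι (suc (k ∸ i))) ≡ δ (p ^ k)
  recurrence k = trans (sym (sum₀-cong k (λ i _ → cong (s i ⊗_) (σ₀-prime-power (k ∸ i) pp))))
                       (trans (sym (pairSum-prime-power k pp _)) (σ₀⁻¹⋆σ₀≡δ (p ^ k) (ℕ.m^n>0 p k)))

  δ-p^[1+k] : ∀ k → δ (p ^ suc k) ≡ 0ℚ
  δ-p^[1+k] k = if-no (p ^ suc k ≟ 1) (ℕ.<⇒≢ (prime⇒>1 pp) ∘ sym ∘ ℕ.m*n≡1⇒m≡1 p (p ^ k))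

  σ₀⁻¹-p¹ : s 1 ≡ ⊖ ι 2
  σ₀⁻¹-p¹ = last-term (0ℚ ⊕ 1ℚ ⊗ ι 2) (s 1) (trans (recurrence 1) (δ-p^[1+k] 0))

  σ₀⁻¹-p² : s 2 ≡ 1ℚ
  σ₀⁻¹-p² = last-term (0ℚ ⊕ 1ℚ ⊗ ι 3 ⊕ (⊖ ι 2) ⊗ ι 2) (s 2)
    (trans (cong (λ y → 0ℚ ⊕ 1ℚ ⊗ ι 3 ⊕ y ⊗ ι 2 ⊕ s 2 ⊗ 1ℚ) (sym σ₀⁻¹-p¹)) (trans (recurrence 2) (δ-p^[1+k] 1)))

  -- In the recurrence for s (3 + r) only s 0, s 1, s 2 contribute, and (r + 4) − 2 (r + 3) + (r + 2) = 0.
  σ₀⁻¹-p^[3+r] : ∀ r → s (3 + r) ≡ 0ℚ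
  σ₀⁻¹-p^[3+r] = <-rec (λ r → s (3 + r) ≡ 0ℚ) step
    where
    step : ∀ r → (∀ {r′} → r′ < r → s (3 + r′) ≡ 0ℚ) → s (3 + r) ≡ 0ℚ
    step r ih = trans (last-term (0ℚ ⊕ h 0 ⊕ h 1 ⊕ h 2) (s k) (begin
        0ℚ ⊕ h 0 ⊕ h 1 ⊕ h 2 ⊕ s k ⊗ 1ℚ
      ≡⟨ cong₂ _⊕_ (sym (sum₀-first-three r h lower-terms)) (cong (λ t → s k ⊗ ι (suc t)) (sym (ℕ.n∸n≡0 k))) ⟩
        sum₀ k h
      ≡⟨ trans (recurrence k) (δ-p^[1+k] (2 + r)) ⟩
        0ℚ
      ∎)) (cong ⊖_ lower-sum)
      where
      open ≡-Reasoning
      k = 3 + r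
      h : ℕ → ℚ
      h i = s i ⊗ ι (suc (k ∸ i))
      lower-terms : ∀ i → 3 ≤ i → i ≤ 2 + r → h i ≡ 0ℚ
      lower-terms (suc (suc (suc r′))) (s≤s (s≤s (s≤s _))) (s≤s (s≤s r′<r)) =
        trans (cong (_⊗ ι (suc (k ∸ (3 + r′)))) (ih {r′} r′<r)) (ℚ.*-zeroˡ (ι (suc (k ∸ (3 + r′)))))
      a = ι r
      lower-sum : 0ℚ ⊕ h 0 ⊕ h 1 ⊕ h 2 ≡ 0ℚ
      lower-sum = begin
          0ℚ ⊕ h 0 ⊕ h 1 ⊕ h 2
        ≡⟨ cong₂ (λ x y → 0ℚ ⊕ 1ℚ ⊗ ι (4 + r) ⊕ x ⊗ ι (3 + r) ⊕ y ⊗ ι (2 + r)) σ₀⁻¹-p¹ σ₀⁻¹-p² ⟩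
          0ℚ ⊕ 1ℚ ⊗ ι (4 + r) ⊕ (⊖ ι 2) ⊗ ι (3 + r) ⊕ 1ℚ ⊗ ι (2 + r)
        ≡⟨ cong₂ (λ x y → 0ℚ ⊕ 1ℚ ⊗ x ⊕ (⊖ ι 2) ⊗ y ⊕ 1ℚ ⊗ ι (2 + r)) (ι-homo-+ 4 r) (ι-homo-+ 3 r) ⟩
          0ℚ ⊕ 1ℚ ⊗ (ι 4 ⊕ a) ⊕ (⊖ ι 2) ⊗ (ι 3 ⊕ a) ⊕ 1ℚ ⊗ ι (2 + r)
        ≡⟨ cong (λ z → 0ℚ ⊕ 1ℚ ⊗ (ι 4 ⊕ a) ⊕ (⊖ ι 2) ⊗ (ι 3 ⊕ a) ⊕ 1ℚ ⊗ z) (ι-homo-+ 2 r) ⟩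
          0ℚ ⊕ 1ℚ ⊗ (ι 4 ⊕ a) ⊕ (⊖ ι 2) ⊗ (ι 3 ⊕ a) ⊕ 1ℚ ⊗ (ι 2 ⊕ a)
        ≡⟨ solve 1 (λ a → con 0ℚ :+ con 1ℚ :* (con (ι 4) :+ a) :+ con (⊖ ι 2) :* (con (ι 3) :+ a)
                            :+ con 1ℚ :* (con (ι 2) :+ a) := con 0ℚ) refl a ⟩
          0ℚ
        ∎
        where open ℚ-Solver using (solve; _:+_; _:*_; _:=_; con)

-- Dedekind's ψ and the function v

-- primeProd M (suc k) is definitionally primeProd M k ⊗ primeProdFactor M k.
primeProdFactor : ℕ → ℕ → ℚ
primeProdFactor M k = if does (prime? (suc k)) ∧ does (suc k ∣? M) then + (suc (suc k)) / suc k else 1ℚ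

if∧-yes : ∀ {P Q : Set} (P? : Dec P) (Q? : Dec Q) {A : ℚ} → P → Q → (if does P? ∧ does Q? then A else 1ℚ) ≡ A
if∧-yes P? Q? {A} p q = cong₂ (λ a b → if a ∧ b then A else 1ℚ) (dec-true P? p) (dec-true Q? q)

if∧-no : ∀ {P Q : Set} (P? : Dec P) (Q? : Dec Q) {A : ℚ} → ¬ (P × Q) → (if does P? ∧ does Q? then A else 1ℚ) ≡ 1ℚ
if∧-no (yes p) (yes q) ¬pq = ⊥-elim (¬pq (p , q))
if∧-no (yes _) (no  _) _   = refl
if∧-no (no  _) _       _   = refl

primeProdFactor-∤ : ∀ M k → ¬ (suc k ∣ M) → primeProdFactor M k ≡ 1ℚ
primeProdFactor-∤ M k q∤M = if∧-no (prime? (suc k)) (suc k ∣? M) (q∤M ∘ proj₂)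

primeProdFactor-coprime : ∀ {m n} → Coprime m n → ∀ k → primeProdFactor (m * n) k ≡ primeProdFactor m k ⊗ primeProdFactor n k
primeProdFactor-coprime {m} {n} cop k = split (prime? q) (q ∣? m * n) (q ∣? m) (q ∣? n)
  where
  q = suc k
  F = + suc q / q
  split : (Q : Dec (Prime q)) (A : Dec (q ∣ m * n)) (B : Dec (q ∣ m)) (C : Dec (q ∣ n)) →
          (if does Q ∧ does A then F else 1ℚ) ≡ (if does Q ∧ does B then F else 1ℚ) ⊗ (if does Q ∧ does C then F else 1ℚ)
  split (no _) _ _ _ = refl
  split (yes pq) (yes _)    (yes q∣m) (yes q∣n) = ⊥-elim (ℕ.<⇒≢ (prime⇒>1 pq) (sym (cop (q∣m , q∣n))))
  split (yes _)  (yes _)    (yes _)   (no  _)   = sym (ℚ.*-identityʳ F)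
  split (yes _)  (yes _)    (no  _)   (yes _)   = sym (ℚ.*-identityˡ F)
  split (yes pq) (yes q∣mn) (no q∤m)  (no q∤n)  = ⊥-elim ([ q∤m , q∤n ] (euclidsLemma m n pq q∣mn))
  split (yes _)  (no q∤mn)  (yes q∣m) _         = ⊥-elim (q∤mn (∣m⇒∣m*n n q∣m))
  split (yes _)  (no q∤mn)  (no _)    (yes q∣n) = ⊥-elim (q∤mn (∣n⇒∣m*n m q∣n))
  split (yes _)  (no _)     (no _)    (no _)    = refl

primeProd-coprime : ∀ {m n} → Coprime m n → ∀ K → primeProd (m * n) K ≡ primeProd m K ⊗ primeProd n K
primeProd-coprime cop zero    = refl
primeProd-coprime {m} {n} cop (suc K) =
  trans (cong₂ _⊗_ (primeProd-coprime cop K) (primeProdFactor-coprime cop K))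
        (*-interchange (primeProd m K) (primeProd n K) (primeProdFactor m K) (primeProdFactor n K))

primeProd-extend : ∀ M {m K} → m ≤ K → (∀ k → m ≤ k → k < K → primeProdFactor M k ≡ 1ℚ) → primeProd M K ≡ primeProd M m
primeProd-extend M {m} {suc K} m≤1+K ones with ℕ.m≤n⇒m<n∨m≡n m≤1+K
... | inj₂ refl = refl
... | inj₁ (s≤s m≤K) =
  trans (cong₂ _⊗_ (primeProd-extend M m≤K (λ k m≤k k<K → ones k m≤k (ℕ.m<n⇒m<1+n k<K))) (ones K m≤K ℕ.≤-refl))
        (ℚ.*-identityʳ (primeProd M m))
primeProd-extend M {zero} {zero} z≤n _ = refl

primeProd-single : ∀ M {a K} → a < K → (∀ k → k < K → k ≢ a → primeProdFactor M k ≡ 1ℚ) → primeProd M K ≡ primeProdFactor M a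
primeProd-single M {a} {suc K} a<1+K ones with ℕ.m≤n⇒m<n∨m≡n a<1+K
... | inj₂ refl = trans (cong (_⊗ primeProdFactor M a) (primeProd-extend M z≤n (λ k _ k<a → ones k (ℕ.m<n⇒m<1+n k<a) (ℕ.<⇒≢ k<a))))
                        (ℚ.*-identityˡ _)
... | inj₁ (s≤s a<K) =
  trans (cong₂ _⊗_ (primeProd-single M a<K (λ k k<K → ones k (ℕ.m<n⇒m<1+n k<K))) (ones K ℕ.≤-refl (ℕ.<⇒≢ a<K ∘ sym)))
        (ℚ.*-identityʳ _)

ψ : Arith
ψ M = ι M ⊗ primeProd M M

ψ-multiplicative : Multiplicative ψ
ψ-multiplicative m n 1≤m 1≤n cop =
  trans (cong₂ _⊗_ (ι-homo-* m n) (trans (primeProd-coprime cop (m * n))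
          (cong₂ _⊗_ (primeProd-extend m (ℕ.m≤m*n m n {{ℕ.>-nonZero 1≤n}}) (λ k m≤k _ → primeProdFactor-∤ m k (beyond 1≤m m≤k)))
                     (primeProd-extend n (ℕ.m≤n*m n m {{ℕ.>-nonZero 1≤m}}) (λ k n≤k _ → primeProdFactor-∤ n k (beyond 1≤n n≤k))))))
        (*-interchange (ι m) (ι n) (primeProd m m) (primeProd n n))
  where
  beyond : ∀ {M k} → 1 ≤ M → M ≤ k → ¬ (suc k ∣ M)
  beyond 1≤M M≤k k+1∣M = ℕ.<⇒≱ (s≤s M≤k) (divisor-≤ 1≤M k+1∣M)

12⊗c₁≡ψ : ∀ M → ι 12 ⊗ c₁ M ≡ ψ M
12⊗c₁≡ψ M = trans (solve 3 (λ a b c → a :* (b :* c) := (b :* a) :* c) refl (ι 12) (+ M / 12) (primeProd M M))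
                  (cong (_⊗ primeProd M M) (/-*-cancel (+ M) 11))
  where open ℚ-Solver using (solve; _:*_; _:=_)

v≡ψ⋆σ₀⁻¹ : ∀ M → v M ≡ (ψ ⋆ σ₀⁻¹) M
v≡ψ⋆σ₀⁻¹ M = trans (*-distribˡ-pairSum M (ι 12) (λ d e → c₁ d ⊗ σ₀⁻¹ e))
  (pairSum-cong M (λ d e _ → trans (sym (ℚ.*-assoc (ι 12) (c₁ d) (σ₀⁻¹ e))) (cong (_⊗ σ₀⁻¹ e) (12⊗c₁≡ψ d))))

v-multiplicative : Multiplicative v
v-multiplicative = multiplicative-resp {ψ ⋆ σ₀⁻¹} (λ n _ → sym (v≡ψ⋆σ₀⁻¹ n))
                     (⋆-multiplicative {ψ} {σ₀⁻¹} ψ-multiplicative σ₀⁻¹-multiplicative)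

ψ-prime-power : ∀ {p} j → Prime p → ψ (p ^ suc j) ≡ ι (p ^ j) ⊗ ι (suc p)
ψ-prime-power {p@(suc p-1)} j pp = begin
    ι (p * p ^ j) ⊗ primeProd (p ^ suc j) (p ^ suc j)
  ≡⟨ cong₂ _⊗_ (ι-homo-* p (p ^ j)) (primeProd-single (p ^ suc j) (ℕ.m≤m*n p (p ^ j) {{ℕ.m^n≢0 p j}}) other-primes) ⟩
    (ι p ⊗ ι (p ^ j)) ⊗ primeProdFactor (p ^ suc j) p-1
  ≡⟨ cong ((ι p ⊗ ι (p ^ j)) ⊗_) p-factor ⟩
    (ι p ⊗ ι (p ^ j)) ⊗ (+ suc p / p)
  ≡⟨ solve 3 (λ a b c → (a :* b) :* c := b :* (c :* a)) refl (ι p) (ι (p ^ j)) (+ suc p / p) ⟩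
    ι (p ^ j) ⊗ ((+ suc p / p) ⊗ ι p)
  ≡⟨ cong (ι (p ^ j) ⊗_) (/-*-cancel (+ suc p) p-1) ⟩
    ι (p ^ j) ⊗ ι (suc p)
  ∎
  where
  open ≡-Reasoning
  open ℚ-Solver using (solve; _:*_; _:=_)
  other-primes : ∀ k → k < p ^ suc j → k ≢ p-1 → primeProdFactor (p ^ suc j) k ≡ 1ℚ
  other-primes k _ k≢p-1 = if∧-no (prime? (suc k)) (suc k ∣? p ^ suc j)
    (λ (pq , q∣p^j+1) → k≢p-1 (ℕ.suc-injective (prime∣p^k⇒≡p (suc j) pp pq q∣p^j+1)))
  p-factor : primeProdFactor (p ^ suc j) p-1 ≡ + suc p / p
  p-factor = if∧-yes (prime? p) (p ∣? p ^ suc j) pp (m∣m*n (p ^ j))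

module VAtPrimePowers {p} (pp : Prime p) where

  open DivisorInverseAtPrimePowers pp using (s; σ₀⁻¹-p¹; σ₀⁻¹-p²; σ₀⁻¹-p^[3+r])
  open ℚ-Solver using (solve; _:+_; _:-_; _:*_; :-_; _:=_; con)
  open ≡-Reasoning

  x : ℚ
  x = ι p

  ι-p^suc : ∀ k → ι (p ^ suc k) ≡ x ⊗ ι (p ^ k)
  ι-p^suc k = ι-homo-* p (p ^ k)

  ι-p² : ι (p ^ 2) ≡ x ⊗ (x ⊗ 1ℚ)
  ι-p² = trans (ι-p^suc 1) (cong (x ⊗_) (ι-p^suc 0))

  ι-p³ : ι (p ^ 3) ≡ x ⊗ (x ⊗ (x ⊗ 1ℚ))
  ι-p³ = trans (ι-p^suc 2) (cong (x ⊗_) ι-p²)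

  ψ-p^[1+j] : ∀ j → ψ (p ^ suc j) ≡ ι (p ^ j) ⊗ (1ℚ ⊕ x)
  ψ-p^[1+j] j = trans (ψ-prime-power j pp) (cong (ι (p ^ j) ⊗_) (ι-suc p))

  v-expansion : ∀ n → v (p ^ n) ≡ sum₀ n (λ i → ψ (p ^ i) ⊗ s (n ∸ i))
  v-expansion n = trans (v≡ψ⋆σ₀⁻¹ (p ^ n)) (pairSum-prime-power n pp _)

  v-p¹ : v (p ^ 1) ≡ x ⊖ 1ℚ
  v-p¹ = begin
      v (p ^ 1)
    ≡⟨ v-expansion 1 ⟩
      0ℚ ⊕ ψ 1 ⊗ s 1 ⊕ ψ (p ^ 1) ⊗ s 0
    ≡⟨ cong₂ (λ a b → 0ℚ ⊕ ψ 1 ⊗ a ⊕ b ⊗ s 0) σ₀⁻¹-p¹ (ψ-p^[1+j] 0) ⟩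
      0ℚ ⊕ 1ℚ ⊗ (⊖ ι 2) ⊕ (1ℚ ⊗ (1ℚ ⊕ x)) ⊗ 1ℚ
    ≡⟨ solve 1 (λ x → con 0ℚ :+ con 1ℚ :* con (⊖ ι 2) :+ (con 1ℚ :* (con 1ℚ :+ x)) :* con 1ℚ := x :- con 1ℚ) refl x ⟩
      x ⊖ 1ℚ
    ∎

  v-p² : v (p ^ 2) ≡ ι (p ^ 2) ⊖ x ⊖ 1ℚ
  v-p² = begin
      v (p ^ 2)
    ≡⟨ v-expansion 2 ⟩
      0ℚ ⊕ ψ 1 ⊗ s 2 ⊕ ψ (p ^ 1) ⊗ s 1 ⊕ ψ (p ^ 2) ⊗ s 0
    ≡⟨ cong₂ (λ a b → 0ℚ ⊕ ψ 1 ⊗ a ⊕ ψ (p ^ 1) ⊗ b ⊕ ψ (p ^ 2) ⊗ s 0) σ₀⁻¹-p² σ₀⁻¹-p¹ ⟩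
      0ℚ ⊕ 1ℚ ⊗ 1ℚ ⊕ ψ (p ^ 1) ⊗ (⊖ ι 2) ⊕ ψ (p ^ 2) ⊗ 1ℚ
    ≡⟨ cong₂ (λ a b → 0ℚ ⊕ 1ℚ ⊗ 1ℚ ⊕ a ⊗ (⊖ ι 2) ⊕ b ⊗ 1ℚ)
         (ψ-p^[1+j] 0) (trans (ψ-p^[1+j] 1) (cong (_⊗ (1ℚ ⊕ x)) (ι-p^suc 0))) ⟩
      0ℚ ⊕ 1ℚ ⊗ 1ℚ ⊕ (1ℚ ⊗ (1ℚ ⊕ x)) ⊗ (⊖ ι 2) ⊕ ((x ⊗ 1ℚ) ⊗ (1ℚ ⊕ x)) ⊗ 1ℚ
    ≡⟨ solve 1 (λ x → con 0ℚ :+ con 1ℚ :* con 1ℚ :+ (con 1ℚ :* (con 1ℚ :+ x)) :* con (⊖ ι 2)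
                         :+ ((x :* con 1ℚ) :* (con 1ℚ :+ x)) :* con 1ℚ
                       := x :* (x :* con 1ℚ) :- x :- con 1ℚ) refl x ⟩
      x ⊗ (x ⊗ 1ℚ) ⊖ x ⊖ 1ℚ
    ≡⟨ cong (λ a → a ⊖ x ⊖ 1ℚ) (sym ι-p²) ⟩
      ι (p ^ 2) ⊖ x ⊖ 1ℚ
    ∎

  -- Only the terms with ψ (p ^ i), i ≥ 1 + j, survive, since σ₀⁻¹ vanishes on cubes and higher prime powers.
  v-p^[3+j] : ∀ j → v (p ^ (3 + j)) ≡ (ι (p ^ 3) ⊖ ι (p ^ 2) ⊖ x ⊕ 1ℚ) ⊗ ι (p ^ j)
  v-p^[3+j] j = begin
      v (p ^ n)
    ≡⟨ v-expansion n ⟩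
      sum₀ j h ⊕ h (1 + j) ⊕ h (2 + j) ⊕ h n
    ≡⟨ cong (λ z → z ⊕ h (1 + j) ⊕ h (2 + j) ⊕ h n) low-terms ⟩
      0ℚ ⊕ h (1 + j) ⊕ h (2 + j) ⊕ h n
    ≡⟨ cong₂ (λ a b → 0ℚ ⊕ a ⊕ b ⊕ h n) h[1+j] h[2+j] ⟩
      0ℚ ⊕ (y ⊗ (1ℚ ⊕ x)) ⊗ 1ℚ ⊕ ((x ⊗ y) ⊗ (1ℚ ⊕ x)) ⊗ (⊖ ι 2) ⊕ h n
    ≡⟨ cong (λ c → 0ℚ ⊕ (y ⊗ (1ℚ ⊕ x)) ⊗ 1ℚ ⊕ ((x ⊗ y) ⊗ (1ℚ ⊕ x)) ⊗ (⊖ ι 2) ⊕ c) h[3+j] ⟩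
      0ℚ ⊕ (y ⊗ (1ℚ ⊕ x)) ⊗ 1ℚ ⊕ ((x ⊗ y) ⊗ (1ℚ ⊕ x)) ⊗ (⊖ ι 2) ⊕ ((x ⊗ (x ⊗ y)) ⊗ (1ℚ ⊕ x)) ⊗ 1ℚ
    ≡⟨ solve 2 (λ x y → con 0ℚ :+ (y :* (con 1ℚ :+ x)) :* con 1ℚ :+ ((x :* y) :* (con 1ℚ :+ x)) :* con (⊖ ι 2)
                         :+ ((x :* (x :* y)) :* (con 1ℚ :+ x)) :* con 1ℚ
                       := (x :* (x :* (x :* con 1ℚ)) :- x :* (x :* con 1ℚ) :- x :+ con 1ℚ) :* y) refl x y ⟩
      (x ⊗ (x ⊗ (x ⊗ 1ℚ)) ⊖ x ⊗ (x ⊗ 1ℚ) ⊖ x ⊕ 1ℚ) ⊗ y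
    ≡⟨ cong₂ (λ a b → (a ⊖ b ⊖ x ⊕ 1ℚ) ⊗ y) (sym ι-p³) (sym ι-p²) ⟩
      (ι (p ^ 3) ⊖ ι (p ^ 2) ⊖ x ⊕ 1ℚ) ⊗ y
    ∎
    where
    n = 3 + j
    y = ι (p ^ j)
    h : ℕ → ℚ
    h i = ψ (p ^ i) ⊗ s (n ∸ i)
    low-terms : sum₀ j h ≡ 0ℚ
    low-terms = sum₀-zeros j (λ i i≤j → trans (cong (λ t → ψ (p ^ i) ⊗ s t) (ℕ.+-∸-assoc 3 i≤j))
                                              (trans (cong (ψ (p ^ i) ⊗_) (σ₀⁻¹-p^[3+r] (j ∸ i))) (ℚ.*-zeroʳ (ψ (p ^ i)))))
    h[1+j] : h (1 + j) ≡ (y ⊗ (1ℚ ⊕ x)) ⊗ 1ℚ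
    h[1+j] = cong₂ _⊗_ (ψ-p^[1+j] j) (trans (cong s (ℕ.m+n∸n≡m 2 j)) σ₀⁻¹-p²)
    h[2+j] : h (2 + j) ≡ ((x ⊗ y) ⊗ (1ℚ ⊕ x)) ⊗ (⊖ ι 2)
    h[2+j] = cong₂ _⊗_ (trans (ψ-p^[1+j] (1 + j)) (cong (_⊗ (1ℚ ⊕ x)) (ι-p^suc j))) (trans (cong s (ℕ.m+n∸n≡m 1 j)) σ₀⁻¹-p¹)
    h[3+j] : h n ≡ ((x ⊗ (x ⊗ y)) ⊗ (1ℚ ⊕ x)) ⊗ 1ℚ
    h[3+j] = cong₂ _⊗_ (trans (ψ-p^[1+j] (2 + j)) (cong (_⊗ (1ℚ ⊕ x)) (trans (ι-p^suc (1 + j)) (cong (x ⊗_) (ι-p^suc j)))))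
                       (cong s (ℕ.n∸n≡0 n))

-- The indicator of squares

anyUpTo-witness : ∀ n b → anyUpTo n b ≡ true → ∃ λ m → b m ≡ true
anyUpTo-witness (suc n) b any≡true with anyUpTo n b in eq
... | true  = anyUpTo-witness n b eq
... | false = suc n , any≡true

anyUpTo-intro : ∀ n b {m} → 1 ≤ m → m ≤ n → b m ≡ true → anyUpTo n b ≡ true
anyUpTo-intro zero    b {zero} () _ _
anyUpTo-intro (suc n) b {m} 1≤m m≤1+n bm≡true with ℕ.m≤n⇒m<n∨m≡n m≤1+n
... | inj₂ refl       = trans (cong (anyUpTo n b ∨_) bm≡true) (Bool.∨-zeroʳ (anyUpTo n b))
... | inj₁ (s≤s m≤n) = cong (_∨ b (suc n)) (anyUpTo-intro n b 1≤m m≤n bm≡true)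

anyUpTo-none : ∀ n b → (∀ m → b m ≡ false) → anyUpTo n b ≡ false
anyUpTo-none zero    b _        = refl
anyUpTo-none (suc n) b b≡false = cong₂ _∨_ (anyUpTo-none n b b≡false) (b≡false (suc n))

square-bounds : ∀ x {n} → 1 ≤ n → x * x ≡ n → 1 ≤ x × x ≤ n
square-bounds zero    1≤n refl = ⊥-elim (ℕ.<-irrefl refl 1≤n)
square-bounds (suc x) 1≤n refl = s≤s z≤n , ℕ.m≤m*n (suc x) (suc x)

square? : ∀ n → Dec (IsSquare n)
square? zero = yes (0 , refl)
square? n@(suc _) with anyUpTo n (λ m → does (m * m ≟ n)) in eq
... | true with anyUpTo-witness n _ eq
...   | x , found = yes (x , ℕ.≡ᵇ⇒≡ (x * x) n (subst T (sym found) tt))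
square? n@(suc _) | false
  = no λ (x , xx≡n) → let 1≤x , x≤n = square-bounds x (s≤s z≤n) xx≡n in
                 true≢false (trans (sym (anyUpTo-intro n _ {x} 1≤x x≤n (dec-true (x * x ≟ n) xx≡n))) eq)
  where
  true≢false : true ≢ false
  true≢false ()

sqInd-square : ∀ {n} → 1 ≤ n → IsSquare n → sqInd n ≡ 1ℚ
sqInd-square {n} 1≤n (x , xx≡n) = let 1≤x , x≤n = square-bounds x 1≤n xx≡n in
  cong (λ b → if b then 1ℚ else 0ℚ) (anyUpTo-intro n _ {x} 1≤x x≤n (dec-true (x * x ≟ n) xx≡n))

sqInd-nonsquare : ∀ {n} → ¬ IsSquare n → sqInd n ≡ 0ℚ
sqInd-nonsquare {n} ¬□ = cong (λ b → if b then 1ℚ else 0ℚ) (anyUpTo-none n _ (λ x → dec-false (x * x ≟ n) (λ xx≡n → ¬□ (x , xx≡n))))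

sqInd-multiplicative : Multiplicative sqInd
sqInd-multiplicative m n 1≤m 1≤n cop with square? m | square? n
... | yes (a , aa≡m) | yes (b , bb≡n) =
  trans (sqInd-square (1≤m*n 1≤m 1≤n) (a * b , trans (ℕ-Solver.solve 2 (λ a b → (a :* b) :* (a :* b) := (a :* a) :* (b :* b)) refl a b)
                                                       (cong₂ _*_ aa≡m bb≡n)))
        (sym (cong₂ _⊗_ (sqInd-square 1≤m (a , aa≡m)) (sqInd-square 1≤n (b , bb≡n))))
  where open ℕ-Solver using (_:*_; _:=_)
... | no ¬□m | _ =
  trans (sqInd-nonsquare (¬□m ∘ coprime-product-square cop 1≤m))
        (sym (trans (cong (_⊗ sqInd n) (sqInd-nonsquare ¬□m)) (ℚ.*-zeroˡ (sqInd n))))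
... | yes _ | no ¬□n =
  trans (sqInd-nonsquare (λ (x , xx≡mn) → ¬□n (coprime-product-square (Coprime.sym cop) 1≤n (x , trans xx≡mn (ℕ.*-comm m n)))))
        (sym (trans (cong (sqInd m ⊗_) (sqInd-nonsquare ¬□n)) (ℚ.*-zeroʳ (sqInd m))))

module SquaresAtPrimePowers {p} (pp : Prime p) where

  private instance _ = prime⇒nonZero pp
  open ℕ-Solver using (solve; _:*_; _:=_)

  prime-nonsquare : ¬ IsSquare p
  prime-nonsquare (x , xx≡p) with prime⇒irreducible pp (divides x (sym xx≡p))
  ... | inj₁ refl = ℕ.<⇒≢ (prime⇒>1 pp) xx≡p
  ... | inj₂ refl = ℕ.<⇒≢ (prime⇒>1 pp) (sym (ℕ.*-cancelˡ-≡ p 1 p (trans xx≡p (sym (ℕ.*-identityʳ p)))))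

  square-p^k⇒square-p^[2+k] : ∀ {k} → IsSquare (p ^ k) → IsSquare (p ^ (2 + k))
  square-p^k⇒square-p^[2+k] {k} (x , xx≡p^k) =
    p * x , trans (solve 2 (λ p x → (p :* x) :* (p :* x) := p :* (p :* (x :* x))) refl p x) (cong (λ y → p * (p * y)) xx≡p^k)

  square-p^[2+k]⇒square-p^k : ∀ {k} → IsSquare (p ^ (2 + k)) → IsSquare (p ^ k)
  square-p^[2+k]⇒square-p^k {k} (x , xx≡p^[2+k]) with p∣x
    where
    p∣x : p ∣ x
    p∣x = [ id , id ] (euclidsLemma x x pp (divides (p ^ k * p) (trans xx≡p^[2+k] (solve 2 (λ p y → p :* (p :* y) := y :* p :* p) refl p (p ^ k)))))
  ... | divides q x≡qp = q , ℕ.*-cancelˡ-≡ (q * q) (p ^ k) p (ℕ.*-cancelˡ-≡ (p * (q * q)) (p * p ^ k) p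
    (trans (solve 2 (λ p q → p :* (p :* (q :* q)) := (q :* p) :* (q :* p)) refl p q)
           (trans (cong (λ y → y * y) (sym x≡qp)) xx≡p^[2+k])))

  sqInd-p¹ : sqInd (p ^ 1) ≡ 0ℚ
  sqInd-p¹ = sqInd-nonsquare (λ (x , xx≡p¹) → prime-nonsquare (x , trans xx≡p¹ (ℕ.*-identityʳ p)))

  sqInd-p^[2+k] : ∀ k → sqInd (p ^ (2 + k)) ≡ sqInd (p ^ k)
  sqInd-p^[2+k] k with square? (p ^ k)
  ... | yes □ = trans (sqInd-square (ℕ.m^n>0 p (2 + k)) (square-p^k⇒square-p^[2+k] {k} □)) (sym (sqInd-square (ℕ.m^n>0 p k) □))
  ... | no ¬□ = trans (sqInd-nonsquare (¬□ ∘ square-p^[2+k]⇒square-p^k {k})) (sym (sqInd-nonsquare ¬□))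

-- The Dirichlet series identity

module LSeriesAtPrimePowers {p} (pp : Prime p) where

  open VAtPrimePowers pp using (x; ι-p^suc; ι-p²; ι-p³; v-p¹; v-p²; v-p^[3+j])
  open SquaresAtPrimePowers pp using (sqInd-p¹; sqInd-p^[2+k])
  open ℚ-Solver using (solve; _:+_; _:-_; _:*_; _:=_; con)
  open ≡-Reasoning

  U : ℕ → ℚ
  U j = sum₀ j (λ i → v (p ^ i) ⊗ 1ℚ)

  U-p¹ : U 1 ≡ x
  U-p¹ = trans (cong (λ t → 1ℚ ⊕ t ⊗ 1ℚ) v-p¹) (solve 1 (λ x → con 1ℚ :+ (x :- con 1ℚ) :* con 1ℚ := x) refl x)

  U-p^[2+j] : ∀ j → U (2 + j) ≡ ι (p ^ (2 + j)) ⊖ ι (p ^ j)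
  U-p^[2+j] zero = begin
      U 1 ⊕ v (p ^ 2) ⊗ 1ℚ
    ≡⟨ cong₂ (λ a b → a ⊕ b ⊗ 1ℚ) U-p¹ v-p² ⟩
      x ⊕ (ι (p ^ 2) ⊖ x ⊖ 1ℚ) ⊗ 1ℚ
    ≡⟨ solve 2 (λ x y → x :+ (y :- x :- con 1ℚ) :* con 1ℚ := y :- con 1ℚ) refl x (ι (p ^ 2)) ⟩
      ι (p ^ 2) ⊖ 1ℚ
    ∎
  U-p^[2+j] (suc j) = begin
      U (2 + j) ⊕ v (p ^ (3 + j)) ⊗ 1ℚ
    ≡⟨ cong₂ (λ a b → a ⊕ b ⊗ 1ℚ) (U-p^[2+j] j) (v-p^[3+j] j) ⟩
      ι (p ^ (2 + j)) ⊖ y ⊕ ((ι (p ^ 3) ⊖ ι (p ^ 2) ⊖ x ⊕ 1ℚ) ⊗ y) ⊗ 1ℚ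
    ≡⟨ cong₂ (λ a b → a ⊖ y ⊕ ((b ⊖ ι (p ^ 2) ⊖ x ⊕ 1ℚ) ⊗ y) ⊗ 1ℚ) ι-p^[2+j] ι-p³ ⟩
      x ⊗ (x ⊗ y) ⊖ y ⊕ ((x ⊗ (x ⊗ (x ⊗ 1ℚ)) ⊖ ι (p ^ 2) ⊖ x ⊕ 1ℚ) ⊗ y) ⊗ 1ℚ
    ≡⟨ cong (λ c → x ⊗ (x ⊗ y) ⊖ y ⊕ ((x ⊗ (x ⊗ (x ⊗ 1ℚ)) ⊖ c ⊖ x ⊕ 1ℚ) ⊗ y) ⊗ 1ℚ) ι-p² ⟩
      x ⊗ (x ⊗ y) ⊖ y ⊕ ((x ⊗ (x ⊗ (x ⊗ 1ℚ)) ⊖ x ⊗ (x ⊗ 1ℚ) ⊖ x ⊕ 1ℚ) ⊗ y) ⊗ 1ℚ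
    ≡⟨ solve 2 (λ x y → x :* (x :* y) :- y :+ ((x :* (x :* (x :* con 1ℚ)) :- x :* (x :* con 1ℚ) :- x :+ con 1ℚ) :* y) :* con 1ℚ
                       := x :* (x :* (x :* y)) :- x :* y) refl x y ⟩
      x ⊗ (x ⊗ (x ⊗ y)) ⊖ x ⊗ y
    ≡⟨ cong₂ _⊖_ (sym (trans (ι-p^suc (2 + j)) (cong (x ⊗_) ι-p^[2+j]))) (sym (ι-p^suc j)) ⟩
      ι (p ^ (3 + j)) ⊖ ι (p ^ (1 + j))
    ∎
    where
    y = ι (p ^ j)
    ι-p^[2+j] : ι (p ^ (2 + j)) ≡ x ⊗ (x ⊗ y)
    ι-p^[2+j] = trans (ι-p^suc (1 + j)) (cong (x ⊗_) (ι-p^suc j))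

  E : ℕ → ℚ
  E k = sum₀ k (λ i → U i ⊗ sqInd (p ^ (k ∸ i)))

  [v⋆one]⋆sqInd≡E : ∀ k → ((v ⋆ one) ⋆ sqInd) (p ^ k) ≡ E k
  [v⋆one]⋆sqInd≡E k = trans (pairSum-prime-power k pp _)
                            (sum₀-cong k (λ i _ → cong (_⊗ sqInd (p ^ (k ∸ i))) (pairSum-prime-power i pp _)))

  E-step : ∀ k → E (2 + k) ≡ E k ⊕ U (2 + k)
  E-step k = begin
      sum₀ k h ⊕ h (1 + k) ⊕ h (2 + k)
    ≡⟨ cong₂ (λ a b → a ⊕ b ⊕ h (2 + k)) shifted odd ⟩
      E k ⊕ U (1 + k) ⊗ 0ℚ ⊕ U (2 + k) ⊗ sqInd (p ^ (2 + k ∸ (2 + k)))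
    ≡⟨ cong (λ t → E k ⊕ U (1 + k) ⊗ 0ℚ ⊕ U (2 + k) ⊗ sqInd (p ^ t)) (ℕ.n∸n≡0 (2 + k)) ⟩
      E k ⊕ U (1 + k) ⊗ 0ℚ ⊕ U (2 + k) ⊗ 1ℚ
    ≡⟨ solve 3 (λ a b c → a :+ b :* con 0ℚ :+ c :* con 1ℚ := a :+ c) refl (E k) (U (1 + k)) (U (2 + k)) ⟩
      E k ⊕ U (2 + k)
    ∎
    where
    h : ℕ → ℚ
    h i = U i ⊗ sqInd (p ^ (2 + k ∸ i))
    shifted : sum₀ k h ≡ E k
    shifted = sum₀-cong k (λ i i≤k → cong (U i ⊗_)
      (trans (cong (λ t → sqInd (p ^ t)) (ℕ.+-∸-assoc 2 i≤k)) (sqInd-p^[2+k] (k ∸ i))))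
    odd : h (1 + k) ≡ U (1 + k) ⊗ 0ℚ
    odd = cong (U (1 + k) ⊗_) (trans (cong (λ t → sqInd (p ^ t)) (ℕ.m+n∸n≡m 1 k)) sqInd-p¹)

  E-p^ : ∀ k → E k ≡ ι (p ^ k)
  E-p^ zero = refl
  E-p^ (suc zero) = begin
      0ℚ ⊕ 1ℚ ⊗ sqInd (p ^ 1) ⊕ U 1 ⊗ 1ℚ
    ≡⟨ cong₂ (λ a b → 0ℚ ⊕ 1ℚ ⊗ a ⊕ b ⊗ 1ℚ) sqInd-p¹ U-p¹ ⟩
      0ℚ ⊕ 1ℚ ⊗ 0ℚ ⊕ x ⊗ 1ℚ
    ≡⟨ solve 1 (λ x → con 0ℚ :+ con 1ℚ :* con 0ℚ :+ x :* con 1ℚ := x :* con 1ℚ) refl x ⟩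
      x ⊗ 1ℚ
    ≡⟨ sym (ι-p^suc 0) ⟩
      ι (p ^ 1)
    ∎
  E-p^ (suc (suc k)) = begin
      E (2 + k)
    ≡⟨ E-step k ⟩
      E k ⊕ U (2 + k)
    ≡⟨ cong₂ _⊕_ (E-p^ k) (U-p^[2+j] k) ⟩
      ι (p ^ k) ⊕ (ι (p ^ (2 + k)) ⊖ ι (p ^ k))
    ≡⟨ solve 2 (λ a b → a :+ (b :- a) := b) refl (ι (p ^ k)) (ι (p ^ (2 + k))) ⟩
      ι (p ^ (2 + k))
    ∎

  [v⋆one]⋆sqInd-p^ : ∀ k → ((v ⋆ one) ⋆ sqInd) (p ^ k) ≡ idA (p ^ k)
  [v⋆one]⋆sqInd-p^ k = trans ([v⋆one]⋆sqInd≡E k) (E-p^ k)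

idA-multiplicative : Multiplicative idA
idA-multiplicative m n _ _ _ = ι-homo-* m n

[v⋆one]⋆sqInd≡idA : ∀ n → 1 ≤ n → ((v ⋆ one) ⋆ sqInd) n ≡ idA n
[v⋆one]⋆sqInd≡idA = multiplicative-≡ {(v ⋆ one) ⋆ sqInd} {idA}
  (⋆-multiplicative {v ⋆ one} {sqInd} (⋆-multiplicative {v} {one} v-multiplicative one-multiplicative) sqInd-multiplicative)
  idA-multiplicative refl (λ p k pp _ → LSeriesAtPrimePowers.[v⋆one]⋆sqInd-p^ pp k)

proposition5p2 :
    ((m n : ℕ) → 1 ≤ m → 1 ≤ n → Coprime m n →
      v (m * n) ≡ Data.Rational._*_ (v m) (v n))
    × ((p : ℕ) → Prime p →
        (v (p ^ 0) ≡ 1ℚ)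
        × (v (p ^ 1) ≡ ⟦ + p - + 1 ⟧)
        × (v (p ^ 2) ≡ ⟦ + (p ^ 2) - + p - + 1 ⟧)
        × ((n : ℕ) → 3 ≤ n →
            v (p ^ n) ≡ ⟦ Data.Integer._*_ (+ (p ^ 3) - + (p ^ 2) - + p Data.Integer.+ + 1) (+ (p ^ (n ∸ 3))) ⟧))
    × ((n : ℕ) → 1 ≤ n → ((v ⋆ one) ⋆ sqInd) n ≡ idA n)
proposition5p2 = v-multiplicative , v-prime-powers , [v⋆one]⋆sqInd≡idA
  where
  v-prime-powers : (p : ℕ) → Prime p →
        (v (p ^ 0) ≡ 1ℚ)
        × (v (p ^ 1) ≡ ⟦ + p - + 1 ⟧)
        × (v (p ^ 2) ≡ ⟦ + (p ^ 2) - + p - + 1 ⟧)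
        × ((n : ℕ) → 3 ≤ n →
            v (p ^ n) ≡ ⟦ Data.Integer._*_ (+ (p ^ 3) - + (p ^ 2) - + p Data.Integer.+ + 1) (+ (p ^ (n ∸ 3))) ⟧)
  v-prime-powers p pp =
    refl ,
    trans v-p¹ (sym (⟦⟧-homo-- (+ p) (+ 1))) ,
    trans v-p² (sym (trans (⟦⟧-homo-- (+ (p ^ 2) - + p) (+ 1)) (cong (_⊖ 1ℚ) (⟦⟧-homo-- (+ (p ^ 2)) (+ p))))) ,
    v-p^n
    where
    open VAtPrimePowers pp using (v-p¹; v-p²; v-p^[3+j])
    c = + (p ^ 3) - + (p ^ 2) - + p ℤ.+ + 1
    cubic : ⟦ c ⟧ ≡ ι (p ^ 3) ⊖ ι (p ^ 2) ⊖ ι p ⊕ 1ℚ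
    cubic = trans (⟦⟧-homo-+ (+ (p ^ 3) - + (p ^ 2) - + p) (+ 1)) (cong (_⊕ 1ℚ)
              (trans (⟦⟧-homo-- (+ (p ^ 3) - + (p ^ 2)) (+ p)) (cong (_⊖ ι p) (⟦⟧-homo-- (+ (p ^ 3)) (+ (p ^ 2))))))
    v-p^n : (n : ℕ) → 3 ≤ n → v (p ^ n) ≡ ⟦ c ℤ.* + (p ^ (n ∸ 3)) ⟧
    v-p^n (suc (suc (suc j))) (s≤s (s≤s (s≤s _))) =
      trans (v-p^[3+j] j) (sym (trans (⟦⟧-homo-* c (+ (p ^ j))) (cong (_⊗ ι (p ^ j)) cubic)))
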